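{- Let $S\in\mathcal{I}_1\cap\mathcal{I}_2$ be such that the shortest $s$–$t$ path in $G(S)$ has length $2(\ell+1)$, and let $\Pi_\ell=(B_1,A_1,\dots,A_\ell,B_{\ell+1})$ and $\widetilde{\Pi}_\ell=(\widetilde{B}_1,\widetilde{A}_1,\dots,\widetilde{A}_\ell,\widetilde{B}_{\ell+1})$ be augmenting sets in $G(S)$ with $\Pi_\ell\subseteq\widetilde{\Pi}_\ell$ (i.e. $B_k\subseteq\widetilde{B}_k$ and $A_k\subseteq\widetilde{A}_k$ for all $k$). Let $S'=S\oplus\Pi_\ell:=S+B_1-A_1+B_2-\cdots-A_\ell+B_{\ell+1}$. Then $\widetilde{\Pi}_\ell\setminus\Pi_\ell:=(\widetilde{B}_1\setminus B_1,\widetilde{A}_1\setminus A_1,\dots,\widetilde{B}_{\ell+1}\setminus B_{\ell+1})$ is an augmenting set in $G(S')$, i.e. it satisfies conditions (a)–(f) below with $S$ replaced by $S'$ and the layers $D_i$ replaced by the layers of $G(S')$.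
   Context: $\mathcal{M}_1=(V,\mathcal{I}_1)$, $\mathcal{M}_2=(V,\mathcal{I}_2)$ are matroids. For $T\in\mathcal{I}_1\cap\mathcal{I}_2$, the exchange graph $G(T)$ is the directed graph on $V\cup\{s,t\}$ with arcs: $(s,a)$ for $a\notin T$ with $T+a\in\mathcal{I}_1$; $(a,t)$ for $a\notin T$ with $T+a\in\mathcal{I}_2$; $(a,b)$ for $a\in T$, $b\notin T$ with $T-a+b\in\mathcal{I}_1$; $(b,a)$ for $a\in T$, $b\notin T$ with $T-a+b\in\mathcal{I}_2$. $D_i$ is the set of elements of $V$ at distance exactly $i$ from $s$ in $G(T)$. An augmenting set (with parameter $\ell$) in $G(T)$ is a sequence $(B_1,A_1,\dots,A_\ell,B_{\ell+1})$ with: (a) $A_k\subseteq D_{2k}$, $B_k\subseteq D_{2k-1}$; (b) all sets have the same size $w$ (the width); (c) $T+B_1\in\mathcal{I}_1$; (d) $T+B_{\ell+1}\in\mathcal{I}_2$; (e) $T-A_k+B_{k+1}\in\mathcal{I}_1$ for $1\le k\le\ell$; (f) $T-A_k+B_k\in\mathcal{I}_2$ for $1\le k\le\ell$. It is known that $S\oplus\Pi_\ell\in\mathcal{I}_1\cap\mathcal{I}_2$, so $G(S')$ is defined. -}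

module Defs where

open import Data.Nat using (ℕ; zero; suc; _+_; _*_; _<_)
open import Data.Fin using (Fin; zero; toℕ; inject₁; fromℕ)
import Data.Fin as F
open import Data.Fin.Subset using (Subset; _∈_; _∉_; _⊆_; _∪_; _─_; _-_; ⁅_⁆; ∣_∣; ⊥)
open import Data.Product using (Σ; ∃; _×_; _,_)
open import Relation.Nullary using (¬_; Dec)
open import Relation.Binary.PropositionalEquality using (_≡_)

record Matroid (n : ℕ) : Set₁ where
  field
    Indep       : Subset n → Set
    indep?      : (X : Subset n) → Dec (Indep X)
    indep-∅     : Indep ⊥
    indep-⊆     : ∀ {X Y} → X ⊆ Y → Indep Y → Indep X
    indep-exch  : ∀ {X Y} → Indep X → Indep Y → ∣ X ∣ < ∣ Y ∣ →
                  ∃ λ e → e ∈ Y × e ∉ X × Indep (X ∪ ⁅ e ⁆)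
open Matroid public

module Exchange {n : ℕ} (M₁ M₂ : Matroid n) where

  data Node : Set where
    src  : Node
    sink : Node
    el   : Fin n → Node

  data Arc (T : Subset n) : Node → Node → Set where
    s-arc : ∀ {a} → a ∉ T → Indep M₁ (T ∪ ⁅ a ⁆) → Arc T src (el a)
    t-arc : ∀ {a} → a ∉ T → Indep M₂ (T ∪ ⁅ a ⁆) → Arc T (el a) sink
    arc₁  : ∀ {a b} → a ∈ T → b ∉ T → Indep M₁ ((T - a) ∪ ⁅ b ⁆) → Arc T (el a) (el b)
    arc₂  : ∀ {a b} → a ∈ T → b ∉ T → Indep M₂ ((T - a) ∪ ⁅ b ⁆) → Arc T (el b) (el a)

  data Walk (T : Subset n) : Node → Node → ℕ → Set where
    nil  : ∀ {x} → Walk T x x 0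
    cons : ∀ {x y z k} → Arc T x y → Walk T y z k → Walk T x z (suc k)

  Dist : Subset n → Node → Node → ℕ → Set
  Dist T x y d = Walk T x y d × (∀ j → j < d → ¬ Walk T x y j)

  InLayer : Subset n → ℕ → Fin n → Set
  InLayer T i v = Dist T src (el v) i

  InLayerSet : Subset n → ℕ → Subset n → Set
  InLayerSet T i X = ∀ {v} → v ∈ X → InLayer T i v

  -- An augmenting set (B₁, A₁, …, A_ℓ, B_{ℓ+1}) with parameter ℓ is given by
  -- Bs : Fin (suc ℓ) → Subset n  (Bs i = B_{i+1})
  -- As : Fin ℓ → Subset n        (As i = A_{i+1})
  record IsAugmentingSet (T : Subset n) (ℓ : ℕ)
         (Bs : Fin (suc ℓ) → Subset n) (As : Fin ℓ → Subset n) : Set where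
    field
      width    : ℕ
      layerA   : ∀ (i : Fin ℓ) → InLayerSet T (2 * suc (toℕ i)) (As i)
      layerB   : ∀ (i : Fin (suc ℓ)) → InLayerSet T (suc (2 * toℕ i)) (Bs i)
      sizeA    : ∀ (i : Fin ℓ) → ∣ As i ∣ ≡ width
      sizeB    : ∀ (i : Fin (suc ℓ)) → ∣ Bs i ∣ ≡ width
      first    : Indep M₁ (T ∪ Bs zero)
      last     : Indep M₂ (T ∪ Bs (fromℕ ℓ))
      exch₁    : ∀ (i : Fin ℓ) → Indep M₁ ((T ─ As i) ∪ Bs (F.suc i))
      exch₂    : ∀ (i : Fin ℓ) → Indep M₂ ((T ─ As i) ∪ Bs (inject₁ i))

  _⊕_ : ∀ {ℓ} → Subset n → (Fin (suc ℓ) → Subset n) × (Fin ℓ → Subset n) → Subset n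
  _⊕_ {zero}  S (Bs , As) = S ∪ Bs zero
  _⊕_ {suc ℓ} S (Bs , As) =
    ((S ⊕ ((λ i → Bs (inject₁ i)) , (λ i → As (inject₁ i)))) ─ As (fromℕ ℓ)) ∪ Bs (fromℕ (suc ℓ))

-- Write S' = S ⊕ Π, A'ₖ = Ãₖ ─ Aₖ and B'ₖ = B̃ₖ ─ Bₖ.
--
-- Independence.  If X₁, …, Xₘ ⊆ S and Y₁, …, Yₘ are such that each single exchange S ─ Xⱼ ∪ Yⱼ is
-- independent and there are no shortcuts (Yⱼ' is spanned by S ─ Xⱼ whenever j precedes j'), then all
-- exchanges can be performed at once.  In the layering of G(S) every layer-wise mixture of Π and Π~ is
-- shortcut-free, and S', S' ∪ B'₁, (S' ─ A'ₖ) ∪ B'ₖ₊₁, (S' ─ A'ₖ) ∪ B'ₖ, S' ∪ B'ₗ₊₁ all arise this way.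
--
-- Distances do not decrease.  Up to 2ℓ + 1, an arc of G(S') never leads more than one layer of G(S)
-- further: in M₁ the part of S' not yet reached spans everything S spans beyond the current layer, and
-- dually in M₂ for the part already reached.  So no element of Π~ ─ Π is closer to s in G(S').
--
-- Distances are attained.  As |A'ₖ| = |B'ₖ|, the exchange conditions for Π~ ─ Π give every element of
-- B'ₖ₊₁ an arc from A'ₖ and every element of A'ₖ an arc from B'ₖ in G(S').

module Submission where

open import Defs
open import Data.Nat using (ℕ; zero; suc; _+_; _*_; _∸_; _⊔_; _≤_; _<_; z≤n; s≤s; _≤?_; _≟_)
open import Data.Nat.Properties
open import Data.Bool using (Bool; true; false; if_then_else_)
open import Data.Fin using (Fin; zero; suc; toℕ; inject₁; fromℕ)
open import Data.Fin.Relation.Unary.Top using (view; ‵fromℕ; ‵inject₁)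
open import Data.Fin.Induction using (<-wellFounded; >-wellFounded; <-weakInduction)
open import Data.Fin.Base using () renaming (_<_ to _<ᶠ_; _>_ to _>ᶠ_)
import Data.Fin.Properties as Fin
open import Data.Fin.Subset
open import Data.Fin.Subset.Properties
open import Data.Fin.Subset.Induction using (⊂-wellFounded; ⊃-wellFounded)
open import Data.Vec using ([]; _∷_; here; there; tabulate)
open import Data.Vec.Properties using (lookup∘tabulate; []=⇒lookup; lookup⇒[]=)
open import Data.Product using (∃; ∃-syntax; _×_; _,_; proj₁; proj₂)
open import Data.Sum using (_⊎_; inj₁; inj₂; [_,_]′)
open import Data.Empty using (⊥-elim)
open import Function using (_∘_; flip)
open import Level using (0ℓ)
open import Induction.WellFounded using (Acc; acc)
open import Relation.Nullary using (¬_; Dec; yes; no; does; contradiction)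
open import Relation.Nullary.Decidable using (_×-dec_; _⊎-dec_; _→-dec_; ¬?; decidable-stable)
open import Relation.Unary using (Pred; Decidable)
open import Relation.Binary.PropositionalEquality
  using (_≡_; _≢_; refl; sym; trans; cong; cong₂; subst; subst₂; module ≡-Reasoning)

private variable
  n : ℕ
  p q r : Subset n
  x y : Fin n

x∈p─q⁻ : ∀ (p q : Subset n) → x ∈ p ─ q → x ∈ p × x ∉ q
x∈p─q⁻ (_ ∷ p) (outside ∷ q) here = here , λ ()
x∈p─q⁻ (_ ∷ p) (_ ∷ q) (there x∈p─q) with x∈p─q⁻ p q x∈p─q
... | x∈p , x∉q = there x∈p , x∉q ∘ drop-there

x∈p-y⁻ : ∀ (p : Subset n) → x ∈ p - y → x ∈ p × x ≢ y
x∈p-y⁻ p x∈p-y with x∈p─q⁻ p _ x∈p-y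
... | x∈p , x∉⁅y⁆ = x∈p , x∉⁅y⁆⇒x≢y x∉⁅y⁆

x∈p⇒⁅x⁆⊆p : x ∈ p → ⁅ x ⁆ ⊆ p
x∈p⇒⁅x⁆⊆p {x = x} {p = p} x∈p y∈⁅x⁆ = subst (_∈ p) (sym (x∈⁅y⁆⇒x≡y x y∈⁅x⁆)) x∈p

∪-lub : p ⊆ r → q ⊆ r → p ∪ q ⊆ r
∪-lub {p = p} {q = q} p⊆r q⊆r x∈p∪q = [ p⊆r , q⊆r ]′ (x∈p∪q⁻ p q x∈p∪q)

∪-monoˡ : p ⊆ q → p ∪ r ⊆ q ∪ r
∪-monoˡ {q = q} {r = r} p⊆q = ∪-lub (p⊆p∪q r ∘ p⊆q) (q⊆p∪q q r)

∪-monoʳ : q ⊆ r → p ∪ q ⊆ p ∪ r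
∪-monoʳ {q = q} {r = r} {p = p} q⊆r = ∪-lub (p⊆p∪q r) (q⊆p∪q p r ∘ q⊆r)

─-monoˡ : p ⊆ q → p ─ r ⊆ q ─ r
─-monoˡ {p = p} {r = r} p⊆q x∈p─r with x∈p─q⁻ p r x∈p─r
... | x∈p , x∉r = x∈p∧x∉q⇒x∈p─q (p⊆q x∈p) x∉r

─-antimonoʳ : q ⊆ r → p ─ r ⊆ p ─ q
─-antimonoʳ {r = r} {p = p} q⊆r x∈p─r with x∈p─q⁻ p r x∈p─r
... | x∈p , x∉r = x∈p∧x∉q⇒x∈p─q x∈p (x∉r ∘ q⊆r)

∣p∪q∣≡∣p∣+∣q∣ : ∀ (p q : Subset n) → (∀ {x} → x ∈ p → x ∉ q) → ∣ p ∪ q ∣ ≡ ∣ p ∣ + ∣ q ∣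
∣p∪q∣≡∣p∣+∣q∣ [] [] _ = refl
∣p∪q∣≡∣p∣+∣q∣ (inside ∷ p) (inside ∷ q) disj = contradiction here (disj here)
∣p∪q∣≡∣p∣+∣q∣ (inside ∷ p) (outside ∷ q) disj =
  cong suc (∣p∪q∣≡∣p∣+∣q∣ p q λ x∈p x∈q → disj (there x∈p) (there x∈q))
∣p∪q∣≡∣p∣+∣q∣ (outside ∷ p) (inside ∷ q) disj =
  trans (cong suc (∣p∪q∣≡∣p∣+∣q∣ p q λ x∈p x∈q → disj (there x∈p) (there x∈q))) (sym (+-suc _ _))
∣p∪q∣≡∣p∣+∣q∣ (outside ∷ p) (outside ∷ q) disj =
  ∣p∪q∣≡∣p∣+∣q∣ p q λ x∈p x∈q → disj (there x∈p) (there x∈q)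

∣p─q∣+∣q∣≡∣p∣ : ∀ (p q : Subset n) → q ⊆ p → ∣ p ─ q ∣ + ∣ q ∣ ≡ ∣ p ∣
∣p─q∣+∣q∣≡∣p∣ [] [] _ = refl
∣p─q∣+∣q∣≡∣p∣ (inside ∷ p) (inside ∷ q) q⊆p = trans (+-suc _ _) (cong suc (∣p─q∣+∣q∣≡∣p∣ p q (drop-∷-⊆ q⊆p)))
∣p─q∣+∣q∣≡∣p∣ (outside ∷ p) (inside ∷ q) q⊆p with () ← q⊆p here
∣p─q∣+∣q∣≡∣p∣ (inside ∷ p) (outside ∷ q) q⊆p = cong suc (∣p─q∣+∣q∣≡∣p∣ p q (drop-∷-⊆ q⊆p))
∣p─q∣+∣q∣≡∣p∣ (outside ∷ p) (outside ∷ q) q⊆p = ∣p─q∣+∣q∣≡∣p∣ p q (drop-∷-⊆ q⊆p)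

∣p∪⁅x⁆∣≡1+∣p∣ : ∀ (p : Subset n) → x ∉ p → ∣ p ∪ ⁅ x ⁆ ∣ ≡ suc ∣ p ∣
∣p∪⁅x⁆∣≡1+∣p∣ {x = x} p x∉p = begin
  ∣ p ∪ ⁅ x ⁆ ∣     ≡⟨ ∣p∪q∣≡∣p∣+∣q∣ p ⁅ x ⁆ (λ y∈p y∈⁅x⁆ → x∉p (subst (_∈ p) (x∈⁅y⁆⇒x≡y x y∈⁅x⁆) y∈p)) ⟩
  ∣ p ∣ + ∣ ⁅ x ⁆ ∣ ≡⟨ cong (∣ p ∣ +_) (∣⁅x⁆∣≡1 x) ⟩
  ∣ p ∣ + 1         ≡⟨ +-comm ∣ p ∣ 1 ⟩
  suc ∣ p ∣         ∎
  where open ≡-Reasoning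

1+∣p-x∣≡∣p∣ : ∀ (p : Subset n) → x ∈ p → suc ∣ p - x ∣ ≡ ∣ p ∣
1+∣p-x∣≡∣p∣ {x = x} p x∈p = begin
  suc ∣ p - x ∣         ≡⟨ +-comm 1 _ ⟩
  ∣ p - x ∣ + 1         ≡⟨ cong (∣ p - x ∣ +_) (∣⁅x⁆∣≡1 x) ⟨
  ∣ p - x ∣ + ∣ ⁅ x ⁆ ∣ ≡⟨ ∣p─q∣+∣q∣≡∣p∣ p ⁅ x ⁆ (x∈p⇒⁅x⁆⊆p x∈p) ⟩
  ∣ p ∣                 ∎
  where open ≡-Reasoning

∣p-x∪⁅y⁆∣≡∣p∣ : ∀ (p : Subset n) → x ∈ p → y ∉ p → ∣ (p - x) ∪ ⁅ y ⁆ ∣ ≡ ∣ p ∣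
∣p-x∪⁅y⁆∣≡∣p∣ p x∈p y∉p = trans (∣p∪⁅x⁆∣≡1+∣p∣ (p - _) (y∉p ∘ proj₁ ∘ x∈p-y⁻ p)) (1+∣p-x∣≡∣p∣ p x∈p)

∣p─q∣≡∣p∣∸∣q∣ : ∀ (p q : Subset n) → q ⊆ p → ∣ p ─ q ∣ ≡ ∣ p ∣ ∸ ∣ q ∣
∣p─q∣≡∣p∣∸∣q∣ p q q⊆p = begin
  ∣ p ─ q ∣                 ≡⟨ m+n∸n≡m ∣ p ─ q ∣ ∣ q ∣ ⟨
  ∣ p ─ q ∣ + ∣ q ∣ ∸ ∣ q ∣ ≡⟨ cong (_∸ ∣ q ∣) (∣p─q∣+∣q∣≡∣p∣ p q q⊆p) ⟩
  ∣ p ∣ ∸ ∣ q ∣             ∎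
  where open ≡-Reasoning

∣p─q∪r∣≡∣p∣ : ∀ (p q r : Subset n) → q ⊆ p → (∀ {x} → x ∈ r → x ∉ p) → ∣ q ∣ ≡ ∣ r ∣ → ∣ (p ─ q) ∪ r ∣ ≡ ∣ p ∣
∣p─q∪r∣≡∣p∣ p q r q⊆p r∩p=∅ ∣q∣≡∣r∣ = begin
  ∣ (p ─ q) ∪ r ∣   ≡⟨ ∣p∪q∣≡∣p∣+∣q∣ (p ─ q) r (λ x∈p─q x∈r → r∩p=∅ x∈r (p─q⊆p p q x∈p─q)) ⟩
  ∣ p ─ q ∣ + ∣ r ∣ ≡⟨ cong (∣ p ─ q ∣ +_) ∣q∣≡∣r∣ ⟨
  ∣ p ─ q ∣ + ∣ q ∣ ≡⟨ ∣p─q∣+∣q∣≡∣p∣ p q q⊆p ⟩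
  ∣ p ∣             ∎
  where open ≡-Reasoning

p⊆q∧∣q∣≤∣p∣⇒q⊆p : p ⊆ q → ∣ q ∣ ≤ ∣ p ∣ → q ⊆ p
p⊆q∧∣q∣≤∣p∣⇒q⊆p {p = p} p⊆q ∣q∣≤∣p∣ {x} x∈q with x ∈? p
... | yes x∈p = x∈p
... | no x∉p = contradiction ∣q∣≤∣p∣ (<⇒≱ (p⊂q⇒∣p∣<∣q∣ (p⊆q , x , x∈q , x∉p)))

⟦_⟧ : {P : Pred (Fin n) 0ℓ} → Decidable P → Subset n
⟦ P? ⟧ = tabulate (does ∘ P?)

module _ {P : Pred (Fin n) 0ℓ} (P? : Decidable P) where

  ∈⟦⟧⁻ : x ∈ ⟦ P? ⟧ → P x
  ∈⟦⟧⁻ {x} x∈P with P? x | trans (sym (lookup∘tabulate (does ∘ P?) x)) ([]=⇒lookup x∈P)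
  ... | yes Px | _ = Px
  ... | no _ | ()

  ∈⟦⟧⁺ : P x → x ∈ ⟦ P? ⟧
  ∈⟦⟧⁺ {x} Px = lookup⇒[]= x _ (trans (lookup∘tabulate (does ∘ P?) x) (does-yes (P? x)))
    where
    does-yes : (d : Dec (P x)) → does d ≡ true
    does-yes (yes _) = refl
    does-yes (no ¬Px) = contradiction Px ¬Px

⊆-or-∃∉ : ∀ (p q : Subset n) → p ⊆ q ⊎ ∃[ x ] x ∈ p × x ∉ q
⊆-or-∃∉ p q with Fin.any? (λ x → x ∈? p ×-dec ¬? (x ∈? q))
... | yes witness = inj₂ witness
... | no ¬witness = inj₁ λ {x} x∈p → decidable-stable (x ∈? q) λ x∉q → ¬witness (x , x∈p , x∉q)

-- Span and simultaneous exchanges in a matroid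

Exchanged : ∀ {a b} → Subset n → (Fin a → Subset n) → (Fin b → Subset n) → Pred (Fin n) 0ℓ
Exchanged S Xs Ys x = (x ∈ S × ∀ i → x ∉ Xs i) ⊎ ∃[ j ] x ∈ Ys j

upper-bound : ∀ {m} (f : Fin m → ℕ) → ∃[ K ] ∀ j → f j < K
upper-bound {zero} f = 0 , λ ()
upper-bound {suc m} f with upper-bound (f ∘ suc)
... | K , f<K = suc (f zero) ⊔ K , λ { zero → m≤m⊔n _ K ; (suc j) → ≤-trans (f<K j) (m≤n⊔m _ K) }

module Span {n : ℕ} (M : Matroid n) where

  private
    I : Subset n → Set
    I = Indep M

    variable
      X Y Z K P S : Subset n

  -- For independent X this is membership in the closure of X.
  _∈span_ : Fin n → Subset n → Set
  x ∈span X = x ∈ X ⊎ ¬ I (X ∪ ⁅ x ⁆)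

  _⊆span_ : Subset n → Subset n → Set
  X ⊆span Y = ∀ {x} → x ∈ X → x ∈span Y

  ∈span-mono : X ⊆ Y → x ∈span X → x ∈span Y
  ∈span-mono X⊆Y (inj₁ x∈X) = inj₁ (X⊆Y x∈X)
  ∈span-mono X⊆Y (inj₂ dep) = inj₂ (dep ∘ indep-⊆ M (∪-monoˡ X⊆Y))

  ∉span : x ∉ X → I (X ∪ ⁅ x ⁆) → ¬ x ∈span X
  ∉span x∉X _ (inj₁ x∈X) = x∉X x∈X
  ∉span _ iXx (inj₂ dep) = dep iXx

  ∣∣≤-of-⊆span : I Y → I K → K ⊆span Y → ∣ K ∣ ≤ ∣ Y ∣
  ∣∣≤-of-⊆span {Y} {K} iY iK K⊆Y with ∣ K ∣ ≤? ∣ Y ∣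
  ... | yes ∣K∣≤∣Y∣ = ∣K∣≤∣Y∣
  ... | no ∣K∣≰∣Y∣ with indep-exch M iY iK (≰⇒> ∣K∣≰∣Y∣)
  ...   | e , e∈K , e∉Y , iYe = ⊥-elim ([ e∉Y , (λ dep → dep iYe) ]′ (K⊆Y e∈K))

  augment : I X → I Y → ∣ X ∣ ≤ ∣ Y ∣ →
            ∃[ K ] I K × X ⊆ K × K ⊆ X ∪ Y × ∣ K ∣ ≡ ∣ Y ∣
  augment {X} = go (⊃-wellFounded X)
    where
    go : ∀ {X} → Acc _⊃_ X → I X → I Y → ∣ X ∣ ≤ ∣ Y ∣ →
         ∃[ K ] I K × X ⊆ K × K ⊆ X ∪ Y × ∣ K ∣ ≡ ∣ Y ∣
    go {Y} {X} (acc rs) iX iY ∣X∣≤∣Y∣ with m≤n⇒m<n∨m≡n ∣X∣≤∣Y∣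
    ... | inj₂ ∣X∣≡∣Y∣ = X , iX , (λ x∈X → x∈X) , p⊆p∪q Y , ∣X∣≡∣Y∣
    ... | inj₁ ∣X∣<∣Y∣ with indep-exch M iX iY ∣X∣<∣Y∣
    ...   | e , e∈Y , e∉X , iXe with go (rs X⊂Xe) iXe iY ∣Xe∣≤∣Y∣
      where
      X⊂Xe : X ⊂ X ∪ ⁅ e ⁆
      X⊂Xe = p⊆p∪q ⁅ e ⁆ , e , q⊆p∪q X ⁅ e ⁆ (x∈⁅x⁆ e) , e∉X
      ∣Xe∣≤∣Y∣ : ∣ X ∪ ⁅ e ⁆ ∣ ≤ ∣ Y ∣
      ∣Xe∣≤∣Y∣ = subst (_≤ ∣ Y ∣) (sym (∣p∪⁅x⁆∣≡1+∣p∣ X e∉X)) ∣X∣<∣Y∣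
    ...     | K , iK , Xe⊆K , K⊆XeY , ∣K∣≡∣Y∣ =
      K , iK , Xe⊆K ∘ p⊆p∪q ⁅ e ⁆ , ∪-lub (∪-monoʳ (x∈p⇒⁅x⁆⊆p e∈Y)) (q⊆p∪q X Y) ∘ K⊆XeY , ∣K∣≡∣Y∣

  ∈span-trans : I X → I Y → X ⊆span Y → x ∈span X → x ∈span Y
  ∈span-trans {X} {Y} {x} iX iY X⊆Y x∈X with x ∈? Y | indep? M (Y ∪ ⁅ x ⁆)
  ... | yes x∈Y | _ = inj₁ x∈Y
  ... | no _ | no dep = inj₂ dep
  ... | no x∉Y | yes iYx with x∈X
  ...   | inj₁ x∈X = X⊆Y x∈X
  ...   | inj₂ depX with augment iX iYx ∣X∣≤∣Yx∣
    where
    ∣X∣≤∣Yx∣ : ∣ X ∣ ≤ ∣ Y ∪ ⁅ x ⁆ ∣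
    ∣X∣≤∣Yx∣ = ≤-trans (∣∣≤-of-⊆span iY iX X⊆Y) (≤-trans (n≤1+n _) (≤-reflexive (sym (∣p∪⁅x⁆∣≡1+∣p∣ Y x∉Y))))
  ...     | K , iK , X⊆K , K⊆XYx , ∣K∣≡∣Yx∣ with x ∈? K
  ...       | yes x∈K = ⊥-elim (depX (indep-⊆ M (∪-lub X⊆K (x∈p⇒⁅x⁆⊆p x∈K)) iK))
  ...       | no x∉K = ⊥-elim (1+n≰n (≤-trans (≤-reflexive (trans (sym (∣p∪⁅x⁆∣≡1+∣p∣ Y x∉Y)) (sym ∣K∣≡∣Yx∣)))
                                                (∣∣≤-of-⊆span iY iK K⊆Y)))
    where
    K⊆Y : K ⊆span Y
    K⊆Y {k} k∈K with x∈p∪q⁻ X _ (K⊆XYx k∈K)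
    ... | inj₁ k∈X = X⊆Y k∈X
    ... | inj₂ k∈Yx with x∈p∪q⁻ Y ⁅ x ⁆ k∈Yx
    ...   | inj₁ k∈Y = inj₁ k∈Y
    ...   | inj₂ k∈⁅x⁆ = ⊥-elim (x∉K (subst (_∈ K) (x∈⁅y⁆⇒x≡y x k∈⁅x⁆) k∈K))

  ⊆span-swap : I Z → I Y → Y ⊆span Z → ∣ Z ∣ ≤ ∣ Y ∣ → Z ⊆span Y
  ⊆span-swap {Z} {Y} iZ iY Y⊆Z ∣Z∣≤∣Y∣ {z} z∈Z with z ∈? Y | indep? M (Y ∪ ⁅ z ⁆)
  ... | yes z∈Y | _ = inj₁ z∈Y
  ... | no _ | no dep = inj₂ dep
  ... | no z∉Y | yes iYz = ⊥-elim (<⇒≱ ∣Z∣<∣Yz∣ (∣∣≤-of-⊆span iZ iYz Yz⊆Z))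
    where
    ∣Z∣<∣Yz∣ : ∣ Z ∣ < ∣ Y ∪ ⁅ z ⁆ ∣
    ∣Z∣<∣Yz∣ = subst (∣ Z ∣ <_) (sym (∣p∪⁅x⁆∣≡1+∣p∣ Y z∉Y)) (s≤s ∣Z∣≤∣Y∣)
    Yz⊆Z : (Y ∪ ⁅ z ⁆) ⊆span Z
    Yz⊆Z {y} y∈Yz with x∈p∪q⁻ Y ⁅ z ⁆ y∈Yz
    ... | inj₁ y∈Y = Y⊆Z y∈Y
    ... | inj₂ y∈⁅z⁆ = inj₁ (x∈p⇒⁅x⁆⊆p z∈Z y∈⁅z⁆)

  ⊆span-exchange : ∀ {A B} → I Z → I ((Z ─ A) ∪ B) → A ⊆ Z → B ⊆span Z → (∀ {b} → b ∈ B → b ∉ Z) →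
                   ∣ A ∣ ≡ ∣ B ∣ → Z ⊆span ((Z ─ A) ∪ B)
  ⊆span-exchange {Z} {A} {B} iZ iJ A⊆Z B⊆Z B∩Z=∅ ∣A∣≡∣B∣ =
    ⊆span-swap iZ iJ J⊆Z (≤-reflexive (sym (∣p─q∪r∣≡∣p∣ Z A B A⊆Z B∩Z=∅ ∣A∣≡∣B∣)))
    where
    J⊆Z : ((Z ─ A) ∪ B) ⊆span Z
    J⊆Z x∈J = [ inj₁ ∘ p─q⊆p Z A , B⊆Z ]′ (x∈p∪q⁻ (Z ─ A) B x∈J)

  -- The fundamental circuit of y lies in Z + y.
  ∈span-of-no-exchange : I S → y ∉ S → ¬ I (S ∪ ⁅ y ⁆) → Z ⊆ S →
                         (∀ {x} → x ∈ S → x ∉ Z → ¬ I ((S - x) ∪ ⁅ y ⁆)) → y ∈span Z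
  ∈span-of-no-exchange {S} {y} {Z} iS y∉S depSy Z⊆S no-exchange with indep? M (Z ∪ ⁅ y ⁆)
  ... | no depZy = inj₂ depZy
  ... | yes iZy with ⊆-or-∃∉ S Z
  ...   | inj₁ S⊆Z = ⊥-elim (depSy (indep-⊆ M (∪-monoˡ S⊆Z) iZy))
  ...   | inj₂ (x₀ , x₀∈S , x₀∉Z) with augment iZy iS ∣Zy∣≤∣S∣
    where
    ∣Zy∣≤∣S∣ : ∣ Z ∪ ⁅ y ⁆ ∣ ≤ ∣ S ∣
    ∣Zy∣≤∣S∣ = ≤-trans (p⊆q⇒∣p∣≤∣q∣ (∪-monoˡ Z⊆S-x₀)) (≤-reflexive (∣p-x∪⁅y⁆∣≡∣p∣ S x₀∈S y∉S))
      where
      Z⊆S-x₀ : Z ⊆ S - x₀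
      Z⊆S-x₀ z∈Z = x∈p∧x≢y⇒x∈p-y (Z⊆S z∈Z) λ { refl → x₀∉Z z∈Z }
  ...     | K , iK , Zy⊆K , K⊆ZyS , ∣K∣≡∣S∣ with ⊆-or-∃∉ S K
  ...       | inj₁ S⊆K = ⊥-elim (<⇒≱ ∣S∣<∣Sy∣ (subst (∣ S ∪ ⁅ y ⁆ ∣ ≤_) ∣K∣≡∣S∣ (p⊆q⇒∣p∣≤∣q∣ Sy⊆K)))
    where
    ∣S∣<∣Sy∣ : ∣ S ∣ < ∣ S ∪ ⁅ y ⁆ ∣
    ∣S∣<∣Sy∣ = ≤-reflexive (sym (∣p∪⁅x⁆∣≡1+∣p∣ S y∉S))
    Sy⊆K : S ∪ ⁅ y ⁆ ⊆ K
    Sy⊆K = ∪-lub S⊆K (Zy⊆K ∘ q⊆p∪q Z ⁅ y ⁆)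
  ...       | inj₂ (x , x∈S , x∉K) = ⊥-elim (no-exchange x∈S x∉Z (indep-⊆ M T⊆K iK))
    where
    x∉Z : x ∉ Z
    x∉Z = x∉K ∘ Zy⊆K ∘ p⊆p∪q ⁅ y ⁆
    T : Subset n
    T = (S - x) ∪ ⁅ y ⁆
    K⊆T : K ⊆ T
    K⊆T {k} k∈K with x∈p∪q⁻ (Z ∪ ⁅ y ⁆) S (K⊆ZyS k∈K)
    ... | inj₁ k∈Zy = ∪-monoˡ (λ z∈Z → x∈p∧x≢y⇒x∈p-y (Z⊆S z∈Z) λ z≡x → x∉Z (subst (_∈ Z) z≡x z∈Z)) k∈Zy
    ... | inj₂ k∈S = p⊆p∪q ⁅ y ⁆ (x∈p∧x≢y⇒x∈p-y k∈S λ k≡x → x∉K (subst (_∈ K) k≡x k∈K))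
    T⊆K : T ⊆ K
    T⊆K = p⊆q∧∣q∣≤∣p∣⇒q⊆p K⊆T (≤-reflexive (trans (∣p-x∪⁅y⁆∣≡∣p∣ S x∈S y∉S) (sym ∣K∣≡∣S∣)))

  indep-∪-of-⊆span : I Z → I (P ∪ Y) → Z ⊆span P → (∀ {y} → y ∈ Y → y ∉ P) → I (Z ∪ Y)
  indep-∪-of-⊆span {Y = Y} = go (⊂-wellFounded Y)
    where
    go : ∀ {Y} → Acc _⊂_ Y → I Z → I (P ∪ Y) → Z ⊆span P → (∀ {y} → y ∈ Y → y ∉ P) → I (Z ∪ Y)
    go {Z} {P} {Y} (acc rs) iZ iPY Z⊆P Y∩P=∅ with nonempty? Y
    ... | no Y-empty = indep-⊆ M (∪-lub (λ z∈Z → z∈Z) (λ y∈Y → ⊥-elim (Y-empty (_ , y∈Y)))) iZ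
    ... | yes (y , y∈Y) with indep? M ((Z ∪ (Y - y)) ∪ ⁅ y ⁆)
    ...   | yes iZY'y = indep-⊆ M (∪-lub (p⊆p∪q ⁅ y ⁆ ∘ p⊆p∪q (Y - y)) Y⊆ZY'y) iZY'y
      where
      Y⊆ZY'y : Y ⊆ (Z ∪ (Y - y)) ∪ ⁅ y ⁆
      Y⊆ZY'y {x} x∈Y with x Fin.≟ y
      ... | yes refl = q⊆p∪q (Z ∪ (Y - y)) ⁅ y ⁆ (x∈⁅x⁆ y)
      ... | no x≢y = p⊆p∪q ⁅ y ⁆ (q⊆p∪q Z (Y - y) (x∈p∧x≢y⇒x∈p-y x∈Y x≢y))
    ...   | no dep = ⊥-elim (y∉span (∈span-trans iZY' iPY' ZY'⊆PY' (inj₂ dep)))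
      where
      Y' : Subset n
      Y' = Y - y
      iPY' : I (P ∪ Y')
      iPY' = indep-⊆ M (∪-monoʳ (p─q⊆p Y ⁅ y ⁆)) iPY
      iZY' : I (Z ∪ Y')
      iZY' = go (rs (x∈p⇒p-x⊂p y∈Y)) iZ iPY' Z⊆P (Y∩P=∅ ∘ p─q⊆p Y ⁅ y ⁆)
      ZY'⊆PY' : (Z ∪ Y') ⊆span (P ∪ Y')
      ZY'⊆PY' {x} x∈ZY' with x∈p∪q⁻ Z Y' x∈ZY'
      ... | inj₁ x∈Z = ∈span-mono (p⊆p∪q Y') (Z⊆P x∈Z)
      ... | inj₂ x∈Y' = inj₁ (q⊆p∪q P Y' x∈Y')
      y∉span : ¬ y ∈span (P ∪ Y')
      y∉span (inj₁ y∈PY') with x∈p∪q⁻ P Y' y∈PY'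
      ... | inj₁ y∈P = Y∩P=∅ y∈Y y∈P
      ... | inj₂ y∈Y' = proj₂ (x∈p-y⁻ Y y∈Y') refl
      y∉span (inj₂ depPY'y) = depPY'y (indep-⊆ M (∪-lub (∪-monoʳ (p─q⊆p Y ⁅ y ⁆)) (x∈p⇒⁅x⁆⊆p (q⊆p∪q P Y y∈Y))) iPY)

  -- The exchanges are performed level by level from the top; shortcut-freeness puts everything
  -- already exchanged into the span of S ─ X j when the exchange j is performed.
  module MultiExchange {m : ℕ} (S : Subset n) (X Y : Fin m → Subset n) (level : Fin m → ℕ)
    (iS : I S) (X⊆S : ∀ j → X j ⊆ S) (Y∩S=∅ : ∀ j {y} → y ∈ Y j → y ∉ S)
    (exchange : ∀ j → I ((S ─ X j) ∪ Y j))
    (shortcut-free : ∀ j j' → level j < level j' → Y j' ⊆span (S ─ X j))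
    (level-injective : ∀ {j j'} → level j ≡ level j' → j ≡ j') where

    private
      ExchangedFrom : ℕ → Pred (Fin n) 0ℓ
      ExchangedFrom t x = (x ∈ S × ∀ j → t ≤ level j → x ∉ X j) ⊎ ∃[ j ] t ≤ level j × x ∈ Y j

      exchangedFrom? : ∀ t → Decidable (ExchangedFrom t)
      exchangedFrom? t x = (x ∈? S ×-dec Fin.all? λ j → t ≤? level j →-dec ¬? (x ∈? X j))
                           ⊎-dec Fin.any? λ j → t ≤? level j ×-dec x ∈? Y j

      U : ℕ → Subset n
      U t = ⟦ exchangedFrom? t ⟧

      indep-U-step : ∀ t → I (U (suc t)) → I (U t)
      indep-U-step t iU with Fin.any? (λ j → level j ≟ t)
      ... | no no-level-t = indep-⊆ M (∈⟦⟧⁺ (exchangedFrom? (suc t)) ∘ step ∘ ∈⟦⟧⁻ (exchangedFrom? t)) iU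
        where
        step : ∀ {x} → ExchangedFrom t x → ExchangedFrom (suc t) x
        step (inj₁ (x∈S , x∉X)) = inj₁ (x∈S , λ j t<j → x∉X j (<⇒≤ t<j))
        step (inj₂ (j , t≤j , x∈Y)) = inj₂ (j , ≤∧≢⇒< t≤j (λ t≡j → no-level-t (j , sym t≡j)) , x∈Y)
      ... | yes (p , level-p≡t) =
        indep-⊆ M (Ut⊆ ∘ ∈⟦⟧⁻ (exchangedFrom? t))
          (indep-∪-of-⊆span iW (exchange p) W⊆span (λ y∈Y → Y∩S=∅ p y∈Y ∘ p─q⊆p S (X p)))
        where
        W : Subset n
        W = U (suc t) ─ X p
        iW : I W
        iW = indep-⊆ M (p─q⊆p (U (suc t)) (X p)) iU
        W⊆span : W ⊆span (S ─ X p)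
        W⊆span z∈W with x∈p─q⁻ (U (suc t)) (X p) z∈W
        ... | z∈U , z∉X with ∈⟦⟧⁻ (exchangedFrom? (suc t)) z∈U
        ...   | inj₁ (z∈S , _) = inj₁ (x∈p∧x∉q⇒x∈p─q z∈S z∉X)
        ...   | inj₂ (j , t<j , z∈Y) = shortcut-free p j (subst (_< level j) (sym level-p≡t) t<j) z∈Y
        Ut⊆ : ∀ {x} → ExchangedFrom t x → x ∈ W ∪ Y p
        Ut⊆ (inj₁ (x∈S , x∉X)) = p⊆p∪q (Y p) (x∈p∧x∉q⇒x∈p─q
          (∈⟦⟧⁺ (exchangedFrom? (suc t)) (inj₁ (x∈S , λ j t<j → x∉X j (<⇒≤ t<j))))
          (x∉X p (≤-reflexive (sym level-p≡t))))
        Ut⊆ (inj₂ (j , t≤j , x∈Y)) with j Fin.≟ p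
        ... | yes refl = q⊆p∪q W (Y p) x∈Y
        ... | no j≢p = p⊆p∪q (Y p) (x∈p∧x∉q⇒x∈p─q
          (∈⟦⟧⁺ (exchangedFrom? (suc t))
            (inj₂ (j , ≤∧≢⇒< t≤j (λ t≡j → j≢p (level-injective (trans (sym t≡j) (sym level-p≡t)))) , x∈Y)))
          (Y∩S=∅ j x∈Y ∘ X⊆S p))

      indep-U : ∀ k t → (∀ j → level j < t + k) → I (U t)
      indep-U zero t level<t = indep-⊆ M (U⊆S ∘ ∈⟦⟧⁻ (exchangedFrom? t)) iS
        where
        U⊆S : ∀ {x} → ExchangedFrom t x → x ∈ S
        U⊆S (inj₁ (x∈S , _)) = x∈S
        U⊆S (inj₂ (j , t≤j , _)) = contradiction (≤-trans (level<t j) (≤-reflexive (+-identityʳ t))) (≤⇒≯ t≤j)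
      indep-U (suc k) t level<t+1+k =
        indep-U-step t (indep-U k (suc t) λ j → ≤-trans (level<t+1+k j) (≤-reflexive (+-suc t k)))

    indep-⊆Exchanged : ∀ {V} → (∀ {x} → x ∈ V → Exchanged S X Y x) → I V
    indep-⊆Exchanged V⊆ with upper-bound level
    ... | K , level<K = indep-⊆ M (∈⟦⟧⁺ (exchangedFrom? 0) ∘ from0 ∘ V⊆) (indep-U K 0 level<K)
      where
      from0 : ∀ {x} → Exchanged S X Y x → ExchangedFrom 0 x
      from0 (inj₁ (x∈S , x∉X)) = inj₁ (x∈S , λ j _ → x∉X j)
      from0 (inj₂ (j , x∈Y)) = inj₂ (j , z≤n , x∈Y)

-- Walks and layers of the exchange graph

module ExchangeGraph {n : ℕ} (M₁ M₂ : Matroid n) where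

  open Exchange M₁ M₂ public

  private variable
    T : Subset n
    u v : Fin n
    d i j k : ℕ
    s t w : Node

  _≟ᴺ_ : (s t : Node) → Dec (s ≡ t)
  src  ≟ᴺ src  = yes refl
  sink ≟ᴺ sink = yes refl
  el u ≟ᴺ el v with u Fin.≟ v
  ... | yes refl = yes refl
  ... | no u≢v = no λ { refl → u≢v refl }
  src  ≟ᴺ sink = no λ ()
  src  ≟ᴺ el _ = no λ ()
  sink ≟ᴺ src  = no λ ()
  sink ≟ᴺ el _ = no λ ()
  el _ ≟ᴺ src  = no λ ()
  el _ ≟ᴺ sink = no λ ()

  anyNode? : {P : Node → Set} → (∀ s → Dec (P s)) → Dec (∃ P)
  anyNode? P? with P? src | P? sink | Fin.any? (P? ∘ el)
  ... | yes p | _ | _ = yes (_ , p)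
  ... | _ | yes p | _ = yes (_ , p)
  ... | _ | _ | yes (_ , p) = yes (_ , p)
  ... | no ¬p | no ¬q | no ¬r = no λ { (src , p) → ¬p p ; (sink , p) → ¬q p ; (el u , p) → ¬r (u , p) }

  arc? : ∀ T s t → Dec (Arc T s t)
  arc? T src (el v) with ¬? (v ∈? T) ×-dec indep? M₁ (T ∪ ⁅ v ⁆)
  ... | yes (v∉T , i) = yes (s-arc v∉T i)
  ... | no ¬arc = no λ { (s-arc v∉T i) → ¬arc (v∉T , i) }
  arc? T (el u) sink with ¬? (u ∈? T) ×-dec indep? M₂ (T ∪ ⁅ u ⁆)
  ... | yes (u∉T , i) = yes (t-arc u∉T i)
  ... | no ¬arc = no λ { (t-arc u∉T i) → ¬arc (u∉T , i) }
  arc? T (el u) (el v) with (u ∈? T ×-dec ¬? (v ∈? T) ×-dec indep? M₁ ((T - u) ∪ ⁅ v ⁆))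
                       ⊎-dec (v ∈? T ×-dec ¬? (u ∈? T) ×-dec indep? M₂ ((T - v) ∪ ⁅ u ⁆))
  ... | yes (inj₁ (u∈T , v∉T , i)) = yes (arc₁ u∈T v∉T i)
  ... | yes (inj₂ (v∈T , u∉T , i)) = yes (arc₂ v∈T u∉T i)
  ... | no ¬arc = no λ { (arc₁ u∈T v∉T i) → ¬arc (inj₁ (u∈T , v∉T , i))
                       ; (arc₂ v∈T u∉T i) → ¬arc (inj₂ (v∈T , u∉T , i)) }
  arc? T src src = no λ ()
  arc? T src sink = no λ ()
  arc? T sink _ = no λ ()
  arc? T (el _) src = no λ ()

  walk? : ∀ T s t k → Dec (Walk T s t k)
  walk? T s t zero with s ≟ᴺ t
  ... | yes refl = yes nil
  ... | no s≢t = no λ { nil → s≢t refl }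
  walk? T s t (suc k) with anyNode? (λ w → arc? T s w ×-dec walk? T w t k)
  ... | yes (_ , a , p) = yes (cons a p)
  ... | no ¬walk = no λ { (cons a p) → ¬walk (_ , a , p) }

  snoc : Walk T s t k → Arc T t w → Walk T s w (suc k)
  snoc nil a = cons a nil
  snoc (cons a p) b = cons a (snoc p b)

  unsnoc : Walk T s w (suc k) → ∃[ t ] Walk T s t k × Arc T t w
  unsnoc (cons a nil) = _ , nil , a
  unsnoc (cons a (cons b p)) with unsnoc (cons b p)
  ... | t , q , c = t , cons a q , c

  walk-src-src : Walk T src src k → k ≡ 0
  walk-src-src {k = zero} _ = refl
  walk-src-src {k = suc k} p with unsnoc p
  ... | _ , _ , ()

  walk-parity : Walk T src (el v) k → ∃[ m ] ((v ∈ T × k ≡ 2 * suc m) ⊎ (v ∉ T × k ≡ suc (2 * m)))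
  walk-parity {k = suc k} p with unsnoc p
  ... | _ , q , s-arc v∉T _ with refl ← walk-src-src q = 0 , inj₂ (v∉T , refl)
  ... | _ , q , arc₁ u∈T v∉T _ with walk-parity q
  ...   | m , inj₁ (_ , k≡2[1+m]) = suc m , inj₂ (v∉T , cong suc k≡2[1+m])
  ...   | _ , inj₂ (u∉T , _) = contradiction u∈T u∉T
  walk-parity {k = suc k} p | _ , q , arc₂ v∈T u∉T _ with walk-parity q
  ...   | _ , inj₁ (u∈T , _) = contradiction u∈T u∉T
  ...   | m , inj₂ (_ , k≡1+2m) = m , inj₁ (v∈T , trans (cong suc k≡1+2m) (sym (*-suc 2 m)))

  Reach≤ : Subset n → ℕ → Pred (Fin n) 0ℓ
  Reach≤ T i v = ∃[ j ] j ≤ i × Walk T src (el v) j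

  reach≤? : ∀ T i → Decidable (Reach≤ T i)
  reach≤? T zero v = no λ { (zero , _ , ()) }
  reach≤? T (suc i) v with reach≤? T i v | walk? T src (el v) (suc i)
  ... | yes (j , j≤i , p) | _ = yes (j , m≤n⇒m≤1+n j≤i , p)
  ... | no _ | yes p = yes (suc i , ≤-refl , p)
  ... | no ¬reach | no ¬p = no λ (j , j≤1+i , p) →
    [ (λ j<1+i → ¬reach (j , ≤-pred j<1+i , p)) , (λ { refl → ¬p p }) ]′ (m≤n⇒m<n∨m≡n j≤1+i)

  reach≤-mono : i ≤ j → Reach≤ T i v → Reach≤ T j v
  reach≤-mono i≤j (k , k≤i , p) = k , ≤-trans k≤i i≤j , p

  reach≤-src : Arc T src (el v) → Reach≤ T 1 v
  reach≤-src a = 1 , ≤-refl , cons a nil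

  reach≤-arc : Reach≤ T i u → Arc T (el u) (el v) → Reach≤ T (suc i) v
  reach≤-arc (j , j≤i , p) a = suc j , s≤s j≤i , snoc p a

  dist-≤ : Dist T s t d → Walk T s t j → d ≤ j
  dist-≤ {d = d} {j = j} (_ , shortest) p with d ≤? j
  ... | yes d≤j = d≤j
  ... | no d≰j = contradiction p (shortest j (≰⇒> d≰j))

  dist-unique : Dist T s t d → Dist T s t k → d ≡ k
  dist-unique D D' = ≤-antisym (dist-≤ D (proj₁ D')) (dist-≤ D' (proj₁ D))

  dist-sink-≤ : Dist T src sink d → Reach≤ T i v → Arc T (el v) sink → d ≤ suc i
  dist-sink-≤ D (j , j≤i , p) a = ≤-trans (dist-≤ D (snoc p a)) (s≤s j≤i)

  layer⇒reach≤ : InLayer T d v → Reach≤ T d v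
  layer⇒reach≤ (p , _) = _ , ≤-refl , p

  layer-≤ : InLayer T d v → Reach≤ T j v → d ≤ j
  layer-≤ L (_ , k≤j , p) = ≤-trans (dist-≤ L p) k≤j

  even-layer-∈ : InLayer T (2 * suc k) v → v ∈ T
  even-layer-∈ {k = k} (p , _) with walk-parity p
  ... | _ , inj₁ (v∈T , _) = v∈T
  ... | m , inj₂ (_ , 2[1+k]≡1+2m) = contradiction 2[1+k]≡1+2m (even≢odd (suc k) m)

  odd-layer-∉ : InLayer T (suc (2 * k)) v → v ∉ T
  odd-layer-∉ {k = k} (p , _) with walk-parity p
  ... | _ , inj₂ (v∉T , _) = v∉T
  ... | m , inj₁ (_ , 1+2k≡2[1+m]) = contradiction (sym 1+2k≡2[1+m]) (even≢odd (suc m) k)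

  ∈⊕⁻ : ∀ {ℓ} S (Bs : Fin (suc ℓ) → Subset n) (As : Fin ℓ → Subset n) →
        v ∈ S ⊕ (Bs , As) → Exchanged S As Bs v
  ∈⊕⁻ {ℓ = zero} S Bs As v∈S⊕ with x∈p∪q⁻ S (Bs zero) v∈S⊕
  ... | inj₁ v∈S = inj₁ (v∈S , λ ())
  ... | inj₂ v∈B = inj₂ (zero , v∈B)
  ∈⊕⁻ {v = v} {ℓ = suc ℓ} S Bs As v∈S⊕ with x∈p∪q⁻ _ (Bs (fromℕ (suc ℓ))) v∈S⊕
  ... | inj₂ v∈B = inj₂ (_ , v∈B)
  ... | inj₁ v∈S⊕′─A with x∈p─q⁻ _ (As (fromℕ ℓ)) v∈S⊕′─A
  ...   | v∈S⊕′ , v∉A with ∈⊕⁻ S (Bs ∘ inject₁) (As ∘ inject₁) v∈S⊕′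
  ...     | inj₂ (j , v∈B) = inj₂ (inject₁ j , v∈B)
  ...     | inj₁ (v∈S , v∉As) = inj₁ (v∈S , v∉As′)
    where
    v∉As′ : ∀ i → v ∉ As i
    v∉As′ i with view i
    ... | ‵fromℕ = v∉A
    ... | ‵inject₁ i = v∉As i

  ∈⊕⁺ : ∀ {ℓ} S (Bs : Fin (suc ℓ) → Subset n) (As : Fin ℓ → Subset n) →
        (∀ i j → v ∈ As i → v ∉ Bs j) → Exchanged S As Bs v → v ∈ S ⊕ (Bs , As)
  ∈⊕⁺ {ℓ = zero} S Bs As _ (inj₁ (v∈S , _)) = p⊆p∪q (Bs zero) v∈S
  ∈⊕⁺ {ℓ = zero} S Bs As _ (inj₂ (zero , v∈B)) = q⊆p∪q S (Bs zero) v∈B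
  ∈⊕⁺ {ℓ = suc ℓ} S Bs As A∩B=∅ (inj₁ (v∈S , v∉As)) =
    p⊆p∪q _ (x∈p∧x∉q⇒x∈p─q (∈⊕⁺ S (Bs ∘ inject₁) (As ∘ inject₁) (λ i j → A∩B=∅ (inject₁ i) (inject₁ j))
                                  (inj₁ (v∈S , v∉As ∘ inject₁)))
                             (v∉As (fromℕ ℓ)))
  ∈⊕⁺ {ℓ = suc ℓ} S Bs As A∩B=∅ (inj₂ (j , v∈B)) with view j
  ... | ‵fromℕ = q⊆p∪q _ (Bs (fromℕ (suc ℓ))) v∈B
  ... | ‵inject₁ j =
    p⊆p∪q _ (x∈p∧x∉q⇒x∈p─q (∈⊕⁺ S (Bs ∘ inject₁) (As ∘ inject₁) (λ i j → A∩B=∅ (inject₁ i) (inject₁ j))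
                                  (inj₂ (j , v∈B)))
                             (λ v∈A → A∩B=∅ (fromℕ ℓ) (inject₁ j) v∈A v∈B))

-- Augmenting sets in G(S) and G(S ⊕ Π)

pick : ∀ {m} → (Fin m → Bool) → (Fin m → Subset n) → (Fin m → Subset n) → Fin m → Subset n
pick chosen Xs Xs~ i = if chosen i then Xs~ i else Xs i

module _ {m} {Xs Xs~ : Fin m → Subset n} (Xs⊆Xs~ : ∀ i → Xs i ⊆ Xs~ i) (chosen : Fin m → Bool) (i : Fin m) where

  pick-⊆ : pick chosen Xs Xs~ i ⊆ Xs~ i
  pick-⊆ with chosen i
  ... | true = λ x∈X → x∈X
  ... | false = Xs⊆Xs~ i

  ⊆-pick : Xs i ⊆ pick chosen Xs Xs~ i
  ⊆-pick with chosen i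
  ... | true = Xs⊆Xs~ i
  ... | false = λ x∈X → x∈X

only : ∀ {m} → Fin m → Fin m → Bool
only k j = does (j Fin.≟ k)

only-self : ∀ {m} (k : Fin m) → only k k ≡ true
only-self k with k Fin.≟ k
... | yes _ = refl
... | no k≢k = contradiction refl k≢k

only-self-≡ : ∀ {m} {k j : Fin m} → j ≡ k → only k j ≡ true
only-self-≡ {k = k} refl = only-self k

only-≡ : ∀ {m} {k j : Fin m} → only k j ≡ true → j ≡ k
only-≡ {k = k} {j} chosen with j Fin.≟ k
... | yes j≡k = j≡k

2*-≤-odd : ∀ {a b} → 2 * a ≤ suc (2 * b) → a ≤ b
2*-≤-odd {zero} _ = z≤n
2*-≤-odd {suc a} {zero} h = contradiction (n≤0⇒n≡0 (≤-pred h)) (m+1+n≢0 a)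
2*-≤-odd {suc a} {suc b} h =
  s≤s (2*-≤-odd (≤-pred (≤-pred (subst₂ _≤_ (*-suc 2 a) (cong suc (*-suc 2 b)) h))))

2*-≤-2+2* : ∀ {a b} → 2 * a ≤ suc (suc (2 * b)) → a ≤ suc b
2*-≤-2+2* {a} {b} = *-cancelˡ-≤ 2 ∘ subst (2 * a ≤_) (sym (*-suc 2 b))

odd-≤-odd : ∀ {a b} → suc (2 * a) ≤ suc (2 * b) → a ≤ b
odd-≤-odd = *-cancelˡ-≤ 2 ∘ ≤-pred

module AugmentingSets {n : ℕ} (M₁ M₂ : Matroid n) (S : Subset n) (ℓ : ℕ)
  (iS₁ : Indep M₁ S) (iS₂ : Indep M₂ S)
  (dist-s-t : Exchange.Dist M₁ M₂ S Exchange.src Exchange.sink (2 * suc ℓ)) where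

  open ExchangeGraph M₁ M₂
  private
    module Span₁ = Span M₁
    module Span₂ = Span M₂

  aLayer : Fin ℓ → ℕ
  aLayer i = 2 * suc (toℕ i)

  bLayer : Fin (suc ℓ) → ℕ
  bLayer j = suc (2 * toℕ j)

  aLayer-mono : ∀ {i i'} → toℕ i ≤ toℕ i' → aLayer i ≤ aLayer i'
  aLayer-mono = *-monoʳ-≤ 2 ∘ s≤s

  -- Conditions (a), (c), (e) alone make S ⊕ Π independent in M₁; (a), (d), (f) in M₂.
  module Layered (Bs : Fin (suc ℓ) → Subset n) (As : Fin ℓ → Subset n)
    (layerB : ∀ j → InLayerSet S (bLayer j) (Bs j))
    (layerA : ∀ i → InLayerSet S (aLayer i) (As i)) where

    private
      A⊆S : ∀ i → As i ⊆ S
      A⊆S i = even-layer-∈ {k = toℕ i} ∘ layerA i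

      B∩S=∅ : ∀ j {v} → v ∈ Bs j → v ∉ S
      B∩S=∅ j = odd-layer-∉ {k = toℕ j} ∘ layerB j

      ∉As⇒∉X : ∀ {X : Fin (suc ℓ) → Subset n} → (∀ j {v} → v ∈ X j → ∃[ i ] v ∈ As i) →
               ∀ {v} → Exchanged S As Bs v → Exchanged S X Bs v
      ∉As⇒∉X X⊆As (inj₁ (v∈S , v∉As)) = inj₁ (v∈S , λ j v∈X → let (i , v∈A) = X⊆As j v∈X in v∉As i v∈A)
      ∉As⇒∉X X⊆As (inj₂ v∈B) = inj₂ v∈B

    indep₁-⊆Exchanged : Indep M₁ (S ∪ Bs zero) → (∀ i → Indep M₁ ((S ─ As i) ∪ Bs (suc i))) →
                        ∀ {V} → (∀ {v} → v ∈ V → Exchanged S As Bs v) → Indep M₁ V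
    indep₁-⊆Exchanged first exch₁ V⊆ =
      MultiExchange.indep-⊆Exchanged S X Bs toℕ iS₁ X⊆S B∩S=∅ exchange shortcut-free Fin.toℕ-injective
        (∉As⇒∉X X⊆As ∘ V⊆)
      where
      open Span₁
      X : Fin (suc ℓ) → Subset n
      X zero = ⊥
      X (suc i) = As i
      X⊆As : ∀ j {v} → v ∈ X j → ∃[ i ] v ∈ As i
      X⊆As zero v∈⊥ = contradiction v∈⊥ ∉⊥
      X⊆As (suc i) v∈A = i , v∈A
      X⊆S : ∀ j → X j ⊆ S
      X⊆S j v∈X = let (i , v∈A) = X⊆As j v∈X in A⊆S i v∈A
      exchange : ∀ j → Indep M₁ ((S ─ X j) ∪ Bs j)
      exchange zero = indep-⊆ M₁ (∪-monoˡ (p─q⊆p S ⊥)) first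
      exchange (suc i) = exch₁ i
      X-reach : ∀ j {x} → x ∈ X j → Reach≤ S (2 * toℕ j) x
      X-reach zero x∈⊥ = contradiction x∈⊥ ∉⊥
      X-reach (suc i) x∈A = layer⇒reach≤ (layerA i x∈A)
      shortcut-free : ∀ j j' → toℕ j < toℕ j' → Bs j' ⊆span (S ─ X j)
      shortcut-free j j' j<j' y∈B =
        ∈span-of-no-exchange iS₁ (B∩S=∅ j' y∈B) no-src-arc (p─q⊆p S (X j)) no-exchange
        where
        no-src-arc : ¬ Indep M₁ (S ∪ ⁅ _ ⁆)
        no-src-arc i = <⇒≱ (≤-trans (s≤s z≤n) j<j')
          (odd-≤-odd (layer-≤ (layerB j' y∈B) (reach≤-src (s-arc (B∩S=∅ j' y∈B) i))))
        no-exchange : ∀ {x} → x ∈ S → x ∉ S ─ X j → ¬ Indep M₁ ((S - x) ∪ ⁅ _ ⁆)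
        no-exchange {x} x∈S x∉S─X i with x ∈? X j
        ... | no x∉X = x∉S─X (x∈p∧x∉q⇒x∈p─q x∈S x∉X)
        ... | yes x∈X = <⇒≱ j<j'
          (odd-≤-odd (layer-≤ (layerB j' y∈B) (reach≤-arc (X-reach j x∈X) (arc₁ x∈S (B∩S=∅ j' y∈B) i))))

    indep₂-⊆Exchanged : Indep M₂ (S ∪ Bs (fromℕ ℓ)) → (∀ i → Indep M₂ ((S ─ As i) ∪ Bs (inject₁ i))) →
                        ∀ {V} → (∀ {v} → v ∈ V → Exchanged S As Bs v) → Indep M₂ V
    indep₂-⊆Exchanged last exch₂ V⊆ =
      MultiExchange.indep-⊆Exchanged S X Bs level iS₂ X⊆S B∩S=∅ exchange shortcut-free level-injective
        (∉As⇒∉X X⊆As ∘ V⊆)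
      where
      open Span₂
      X : Fin (suc ℓ) → Subset n
      X j with view j
      ... | ‵fromℕ = ⊥
      ... | ‵inject₁ i = As i
      X⊆As : ∀ j {v} → v ∈ X j → ∃[ i ] v ∈ As i
      X⊆As j v∈X with view j
      ... | ‵fromℕ = contradiction v∈X ∉⊥
      ... | ‵inject₁ i = i , v∈X
      X⊆S : ∀ j → X j ⊆ S
      X⊆S j v∈X = let (i , v∈A) = X⊆As j v∈X in A⊆S i v∈A
      X-layer : ∀ j {x} → x ∈ X j → InLayer S (2 * suc (toℕ j)) x
      X-layer j {x} x∈X with view j
      ... | ‵fromℕ = contradiction x∈X ∉⊥
      ... | ‵inject₁ i = subst (λ k → InLayer S (2 * suc k) x) (sym (Fin.toℕ-inject₁ i)) (layerA i x∈X)
      -- M₂-exchanges are performed from the sink side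
      level : Fin (suc ℓ) → ℕ
      level j = ℓ ∸ toℕ j
      level-injective : ∀ {j j'} → level j ≡ level j' → j ≡ j'
      level-injective = Fin.toℕ-injective ∘ ∸-cancelˡ-≡ (≤-pred (Fin.toℕ<n _)) (≤-pred (Fin.toℕ<n _))
      exchange : ∀ j → Indep M₂ ((S ─ X j) ∪ Bs j)
      exchange j with view j
      ... | ‵fromℕ = indep-⊆ M₂ (∪-monoˡ (p─q⊆p S ⊥)) last
      ... | ‵inject₁ i = exch₂ i
      shortcut-free : ∀ j j' → level j < level j' → Bs j' ⊆span (S ─ X j)
      shortcut-free j j' level-j<level-j' y∈B =
        ∈span-of-no-exchange iS₂ (B∩S=∅ j' y∈B) no-sink-arc (p─q⊆p S (X j)) no-exchange
        where
        j'<j : toℕ j' < toℕ j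
        j'<j = ∸-cancelʳ-< level-j<level-j'
        no-sink-arc : ¬ Indep M₂ (S ∪ ⁅ _ ⁆)
        no-sink-arc i = <⇒≱ (≤-trans j'<j (≤-pred (Fin.toℕ<n j))) (≤-pred (2*-≤-2+2*
          (dist-sink-≤ dist-s-t (layer⇒reach≤ (layerB j' y∈B)) (t-arc (B∩S=∅ j' y∈B) i))))
        no-exchange : ∀ {x} → x ∈ S → x ∉ S ─ X j → ¬ Indep M₂ ((S - x) ∪ ⁅ _ ⁆)
        no-exchange {x} x∈S x∉S─X i with x ∈? X j
        ... | no x∉X = x∉S─X (x∈p∧x∉q⇒x∈p─q x∈S x∉X)
        ... | yes x∈X = <⇒≱ j'<j (≤-pred (2*-≤-2+2*
          (layer-≤ (X-layer j x∈X) (reach≤-arc (layer⇒reach≤ (layerB j' y∈B)) (arc₂ x∈S (B∩S=∅ j' y∈B) i)))))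

  module Difference (Bs Bs~ : Fin (suc ℓ) → Subset n) (As As~ : Fin ℓ → Subset n)
    (Π : IsAugmentingSet S ℓ Bs As) (Π~ : IsAugmentingSet S ℓ Bs~ As~)
    (B⊆B~ : ∀ j → Bs j ⊆ Bs~ j) (A⊆A~ : ∀ i → As i ⊆ As~ i) where

    private
      module Π = IsAugmentingSet Π
      module Π~ = IsAugmentingSet Π~

    S' : Subset n
    S' = S ⊕ (Bs , As)

    layerA : ∀ i → InLayerSet S (aLayer i) (As i)
    layerA i = Π~.layerA i ∘ A⊆A~ i

    layerB : ∀ j → InLayerSet S (bLayer j) (Bs j)
    layerB j = Π~.layerB j ∘ B⊆B~ j

    B' : Fin (suc ℓ) → Subset n
    B' j = Bs~ j ─ Bs j

    A' : Fin ℓ → Subset n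
    A' i = As~ i ─ As i

    A~⊆S : ∀ i {v} → v ∈ As~ i → v ∈ S
    A~⊆S i = even-layer-∈ {k = toℕ i} ∘ Π~.layerA i

    B~∩S=∅ : ∀ j {v} → v ∈ Bs~ j → v ∉ S
    B~∩S=∅ j = odd-layer-∉ {k = toℕ j} ∘ Π~.layerB j

    A~-index-unique : ∀ {i i' v} → v ∈ As~ i → v ∈ As~ i' → i ≡ i'
    A~-index-unique {i} {i'} v∈A v∈A' = Fin.toℕ-injective (suc-injective
      (*-cancelˡ-≡ _ _ 2 (dist-unique (Π~.layerA i v∈A) (Π~.layerA i' v∈A'))))

    B~-index-unique : ∀ {j j' v} → v ∈ Bs~ j → v ∈ Bs~ j' → j ≡ j'
    B~-index-unique {j} {j'} v∈B v∈B' = Fin.toℕ-injective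
      (*-cancelˡ-≡ _ _ 2 (suc-injective (dist-unique (Π~.layerB j v∈B) (Π~.layerB j' v∈B'))))

    ∈S'⁻ : ∀ {v} → v ∈ S' → Exchanged S As Bs v
    ∈S'⁻ = ∈⊕⁻ S Bs As

    ∈S'⁺ : ∀ {v} → Exchanged S As Bs v → v ∈ S'
    ∈S'⁺ = ∈⊕⁺ S Bs As λ i j v∈A v∈B → B~∩S=∅ j (B⊆B~ j v∈B) (A~⊆S i (A⊆A~ i v∈A))

    B'∩S'=∅ : ∀ j {v} → v ∈ B' j → v ∉ S'
    B'∩S'=∅ j v∈B' v∈S' with x∈p─q⁻ (Bs~ j) (Bs j) v∈B' | ∈S'⁻ v∈S'
    ... | v∈B~ , _ | inj₁ (v∈S , _) = B~∩S=∅ j v∈B~ v∈S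
    ... | v∈B~ , v∉B | inj₂ (j' , v∈B) = v∉B (subst (λ k → _ ∈ Bs k) (B~-index-unique (B⊆B~ j' v∈B) v∈B~) v∈B)

    A'⊆S' : ∀ i {v} → v ∈ A' i → v ∈ S'
    A'⊆S' i v∈A' with x∈p─q⁻ (As~ i) (As i) v∈A'
    ... | v∈A~ , v∉A = ∈S'⁺ (inj₁ (A~⊆S i v∈A~ , λ i' v∈A →
      v∉A (subst (λ k → _ ∈ As k) (A~-index-unique (A⊆A~ i' v∈A) v∈A~) v∈A)))

    ∈S⇒∈S'⊎∈A : ∀ {v} → v ∈ S → v ∈ S' ⊎ ∃[ k ] v ∈ As k
    ∈S⇒∈S'⊎∈A {v} v∈S with Fin.any? (λ k → v ∈? As k)
    ... | yes v∈A = inj₂ v∈A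
    ... | no v∉A = inj₁ (∈S'⁺ (inj₁ (v∈S , λ k v∈Ak → v∉A (k , v∈Ak))))

    ExchangedFromS' : (Fin ℓ → Bool) → (Fin (suc ℓ) → Bool) → Pred (Fin n) 0ℓ
    ExchangedFromS' chosenA chosenB v =
      (v ∈ S' × ∀ i → chosenA i ≡ true → v ∉ A' i) ⊎ ∃[ j ] chosenB j ≡ true × v ∈ Bs~ j

    -- The conditions on the choices make each exchange condition of the mixture follow from Π or from Π~.
    module Mixture (chosenA : Fin ℓ → Bool) (chosenB : Fin (suc ℓ) → Bool) where

      Bsᶜ : Fin (suc ℓ) → Subset n
      Bsᶜ = pick chosenB Bs Bs~

      Asᶜ : Fin ℓ → Subset n
      Asᶜ = pick chosenA As As~

      open Layered Bsᶜ Asᶜ (λ j → Π~.layerB j ∘ pick-⊆ B⊆B~ chosenB j) (λ i → Π~.layerA i ∘ pick-⊆ A⊆A~ chosenA i)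

      private
        exch-mixed : ∀ (M : Matroid n) i j →
                     (chosenB j ≡ true → chosenA i ≡ true) →
                     Indep M ((S ─ As i) ∪ Bs j) → Indep M ((S ─ As~ i) ∪ Bs~ j) →
                     Indep M ((S ─ Asᶜ i) ∪ Bsᶜ j)
        exch-mixed M i j chosen⇒ exch exch~ with chosenB j
        ... | false = indep-⊆ M (∪-monoˡ (─-antimonoʳ (⊆-pick A⊆A~ chosenA i))) exch
        ... | true rewrite chosen⇒ refl = exch~

      indep₁-mixed : (∀ i → chosenB (suc i) ≡ true → chosenA i ≡ true) →
                     ∀ {V} → (∀ {v} → v ∈ V → Exchanged S Asᶜ Bsᶜ v) → Indep M₁ V
      indep₁-mixed chosen⇒ =
        indep₁-⊆Exchanged first (λ i → exch-mixed M₁ i (suc i) (chosen⇒ i) (Π.exch₁ i) (Π~.exch₁ i))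
        where
        first : Indep M₁ (S ∪ Bsᶜ zero)
        first with chosenB zero
        ... | true = Π~.first
        ... | false = Π.first

      indep₂-mixed : (∀ i → chosenB (inject₁ i) ≡ true → chosenA i ≡ true) →
                     ∀ {V} → (∀ {v} → v ∈ V → Exchanged S Asᶜ Bsᶜ v) → Indep M₂ V
      indep₂-mixed chosen⇒ =
        indep₂-⊆Exchanged last (λ i → exch-mixed M₂ i (inject₁ i) (chosen⇒ i) (Π.exch₂ i) (Π~.exch₂ i))
        where
        last : Indep M₂ (S ∪ Bsᶜ (fromℕ ℓ))
        last with chosenB (fromℕ ℓ)
        ... | true = Π~.last
        ... | false = Π.last

      exchanged-mixed : ∀ {v} → ExchangedFromS' chosenA chosenB v → Exchanged S Asᶜ Bsᶜ v
      exchanged-mixed (inj₂ (j , chosen , v∈B~)) =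
        inj₂ (j , subst (λ c → _ ∈ (if c then Bs~ j else Bs j)) (sym chosen) v∈B~)
      exchanged-mixed (inj₁ (v∈S' , v∉A')) with ∈S'⁻ v∈S'
      ... | inj₂ (j , v∈B) = inj₂ (j , ⊆-pick B⊆B~ chosenB j v∈B)
      ... | inj₁ (v∈S , v∉A) = inj₁ (v∈S , v∉Aᶜ)
        where
        v∉Aᶜ : ∀ i → _ ∉ Asᶜ i
        v∉Aᶜ i with chosenA i in eq
        ... | true = λ v∈A~ → v∉A' i eq (x∈p∧x∉q⇒x∈p─q v∈A~ (v∉A i))
        ... | false = v∉A i

    private
      none : ∀ {m} → Fin m → Bool
      none _ = false

      ∪B'-exchanged : ∀ {R} chosenA j → (∀ {v} → v ∈ R → v ∈ S' × ∀ i → chosenA i ≡ true → v ∉ A' i) →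
                    ∀ {v} → v ∈ R ∪ B' j → ExchangedFromS' chosenA (only j) v
      ∪B'-exchanged {R} chosenA j R⊆ v∈R∪B' with x∈p∪q⁻ R (B' j) v∈R∪B'
      ... | inj₁ v∈R = inj₁ (R⊆ v∈R)
      ... | inj₂ v∈B' = inj₂ (j , only-self j , proj₁ (x∈p─q⁻ (Bs~ j) (Bs j) v∈B'))

      S'─A'-avoids : ∀ k {v} → v ∈ S' ─ A' k → v ∈ S' × ∀ i → only k i ≡ true → v ∉ A' i
      S'─A'-avoids k v∈S'─A' with x∈p─q⁻ S' (A' k) v∈S'─A'
      ... | v∈S' , v∉A' = v∈S' , λ i chosen → subst (λ i → _ ∉ A' i) (sym (only-≡ {k = k} {j = i} chosen)) v∉A'

    indep₁-S' : Indep M₁ S'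
    indep₁-S' = indep₁-mixed (λ _ ()) (λ v∈S' → exchanged-mixed (inj₁ (v∈S' , λ _ ())))
      where open Mixture none none

    indep₂-S' : Indep M₂ S'
    indep₂-S' = indep₂-mixed (λ _ ()) (λ v∈S' → exchanged-mixed (inj₁ (v∈S' , λ _ ())))
      where open Mixture none none

    first' : Indep M₁ (S' ∪ B' zero)
    first' = indep₁-mixed (λ _ ()) (exchanged-mixed ∘ ∪B'-exchanged none zero (λ v∈S' → v∈S' , λ _ ()))
      where open Mixture none (only zero)

    last' : Indep M₂ (S' ∪ B' (fromℕ ℓ))
    last' = indep₂-mixed (λ i chosen → ⊥-elim (Fin.fromℕ≢inject₁ (sym (only-≡ {k = fromℕ ℓ} {j = inject₁ i} chosen))))
                         (exchanged-mixed ∘ ∪B'-exchanged none (fromℕ ℓ) (λ v∈S' → v∈S' , λ _ ()))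
      where open Mixture none (only (fromℕ ℓ))

    exch₁' : ∀ k → Indep M₁ ((S' ─ A' k) ∪ B' (suc k))
    exch₁' k = indep₁-mixed (λ i chosen → only-self-≡ (Fin.suc-injective (only-≡ {k = suc k} {j = suc i} chosen)))
                            (exchanged-mixed ∘ ∪B'-exchanged (only k) (suc k) (S'─A'-avoids k))
      where open Mixture (only k) (only (suc k))

    exch₂' : ∀ k → Indep M₂ ((S' ─ A' k) ∪ B' (inject₁ k))
    exch₂' k = indep₂-mixed (λ i chosen → only-self-≡ (Fin.inject₁-injective (only-≡ {k = inject₁ k} {j = inject₁ i} chosen)))
                            (exchanged-mixed ∘ ∪B'-exchanged (only k) (inject₁ k) (S'─A'-avoids k))
      where open Mixture (only k) (only (inject₁ k))

    open Span₁ using () renaming (_∈span_ to _∈span₁_; _⊆span_ to _⊆span₁_)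
    open Span₂ using () renaming (_∈span_ to _∈span₂_; _⊆span_ to _⊆span₂_)

    private
      unreached? : ∀ X i → Decidable (λ v → v ∈ X × ¬ Reach≤ S i v)
      unreached? X i v = v ∈? X ×-dec ¬? (reach≤? S i v)

      reached? : ∀ X i → Decidable (λ v → v ∈ X × Reach≤ S i v)
      reached? X i v = v ∈? X ×-dec reach≤? S i v

    -- Distances are taken in G(S) also for subsets X of S'.
    Unreached : Subset n → ℕ → Subset n
    Unreached X i = ⟦ unreached? X i ⟧

    Reached : Subset n → ℕ → Subset n
    Reached X i = ⟦ reached? X i ⟧

    module _ (X : Subset n) (i : ℕ) {v : Fin n} where

      unreached⁻ : v ∈ Unreached X i → v ∈ X × ¬ Reach≤ S i v
      unreached⁻ = ∈⟦⟧⁻ (unreached? X i)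

      unreached⁺ : v ∈ X → ¬ Reach≤ S i v → v ∈ Unreached X i
      unreached⁺ v∈X ¬reach = ∈⟦⟧⁺ (unreached? X i) (v∈X , ¬reach)

      reached⁻ : v ∈ Reached X i → v ∈ X × Reach≤ S i v
      reached⁻ = ∈⟦⟧⁻ (reached? X i)

      reached⁺ : v ∈ X → Reach≤ S i v → v ∈ Reached X i
      reached⁺ v∈X reach = ∈⟦⟧⁺ (reached? X i) (v∈X , reach)

    Unreached⊆ : ∀ X i → Unreached X i ⊆ X
    Unreached⊆ X i = proj₁ ∘ unreached⁻ X i

    Reached⊆ : ∀ X i → Reached X i ⊆ X
    Reached⊆ X i = proj₁ ∘ reached⁻ X i

    ∉Unreached⇒reach≤ : ∀ X i {v} → v ∈ X → v ∉ Unreached X i → Reach≤ S i v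
    ∉Unreached⇒reach≤ X i {v} v∈X v∉U = decidable-stable (reach≤? S i v) (v∉U ∘ unreached⁺ X i v∈X)

    A⊆Unreached : ∀ k → As k ⊆ Unreached S (suc (2 * toℕ k))
    A⊆Unreached k v∈A = unreached⁺ S _ (A~⊆S k (A⊆A~ k v∈A)) λ reach →
      contradiction (layer-≤ (Π~.layerA k (A⊆A~ k v∈A)) reach) λ 2[1+k]≤1+2k → 1+n≰n (2*-≤-odd 2[1+k]≤1+2k)

    B⊆span₁-Unreached : ∀ k → Bs (suc k) ⊆span₁ Unreached S (suc (2 * toℕ k))
    B⊆span₁-Unreached k {b} b∈B =
      Span₁.∈span-of-no-exchange iS₁ b∉S no-src-arc (Unreached⊆ S (suc (2 * toℕ k))) no-exchange
      where
      b∉S : b ∉ S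
      b∉S = B~∩S=∅ (suc k) (B⊆B~ (suc k) b∈B)
      L : InLayer S (bLayer (suc k)) b
      L = Π~.layerB (suc k) (B⊆B~ (suc k) b∈B)
      no-src-arc : ¬ Indep M₁ (S ∪ ⁅ b ⁆)
      no-src-arc i with () ← odd-≤-odd {suc (toℕ k)} {0} (layer-≤ L (reach≤-src (s-arc b∉S i)))
      no-exchange : ∀ {x} → x ∈ S → x ∉ Unreached S (suc (2 * toℕ k)) → ¬ Indep M₁ ((S - x) ∪ ⁅ b ⁆)
      no-exchange x∈S x∉U i =
        contradiction (layer-≤ L (reach≤-arc (∉Unreached⇒reach≤ S _ x∈S x∉U) (arc₁ x∈S b∉S i)))
                      λ 3+2k≤2+2k → 1+n≰n (2*-≤-odd (≤-pred 3+2k≤2+2k))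

    -- Z (S without its first 2k + 1 layers) has the same span as (Z ─ Aₖ) ∪ Bₖ₊₁, whose elements are
    -- unreached elements of S' or lie in some later Aₖ', handled by induction on k downwards.
    A⊆span₁-Unreached : ∀ {i} k → Acc _>ᶠ_ k → i < aLayer k → As k ⊆span₁ Unreached S' i
    A⊆span₁-Unreached {i} k (acc rs) i<2[1+k] {v} v∈A =
      Span₁.∈span-trans iJ (indep-⊆ M₁ (Unreached⊆ S' i) indep₁-S') J⊆span (Z⊆span-J (A⊆Unreached k v∈A))
      where
      Z J : Subset n
      Z = Unreached S (suc (2 * toℕ k))
      J = (Z ─ As k) ∪ Bs (suc k)
      Z⊆S : Z ⊆ S
      Z⊆S = Unreached⊆ S (suc (2 * toℕ k))
      iJ : Indep M₁ J
      iJ = indep-⊆ M₁ (∪-monoˡ (─-monoˡ Z⊆S)) (Π.exch₁ k)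
      Z⊆span-J : Z ⊆span₁ J
      Z⊆span-J = Span₁.⊆span-exchange (indep-⊆ M₁ Z⊆S iS₁) iJ (A⊆Unreached k) (B⊆span₁-Unreached k)
                   (λ b∈B → B~∩S=∅ (suc k) (B⊆B~ _ b∈B) ∘ Z⊆S) (trans (Π.sizeA k) (sym (Π.sizeB (suc k))))
      i≤1+2k : i ≤ suc (2 * toℕ k)
      i≤1+2k = ≤-pred (subst (i <_) (*-suc 2 (toℕ k)) i<2[1+k])
      J⊆span : J ⊆span₁ Unreached S' i
      J⊆span y∈J with x∈p∪q⁻ (Z ─ As k) (Bs (suc k)) y∈J
      ... | inj₂ y∈B = inj₁ (unreached⁺ S' i (∈S'⁺ (inj₂ (suc k , y∈B)))
                                          (<⇒≱ (m<n⇒m<1+n i<2[1+k]) ∘ layer-≤ (layerB (suc k) y∈B)))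
      ... | inj₁ y∈Z─A with x∈p─q⁻ Z (As k) y∈Z─A
      ...   | y∈Z , y∉A with unreached⁻ S _ y∈Z
      ...     | y∈S , ¬reach with ∈S⇒∈S'⊎∈A y∈S
      ...       | inj₁ y∈S' = inj₁ (unreached⁺ S' i y∈S' (¬reach ∘ reach≤-mono i≤1+2k))
      ...       | inj₂ (k' , y∈A') = A⊆span₁-Unreached k' (rs k<k') (<-≤-trans i<2[1+k] (aLayer-mono (<⇒≤ k<k'))) y∈A'
        where
        k≤k' : toℕ k ≤ toℕ k'
        k≤k' = ≮⇒≥ λ k'<k → ¬reach (reach≤-mono (m≤n⇒m≤1+n (*-monoʳ-≤ 2 k'<k)) (layer⇒reach≤ (layerA k' y∈A')))
        k<k' : toℕ k < toℕ k'
        k<k' = ≤∧≢⇒< k≤k' λ k≡k' → y∉A (subst (λ k → _ ∈ As k) (sym (Fin.toℕ-injective k≡k')) y∈A')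

    Unreached⊆span₁ : ∀ i → Unreached S i ⊆span₁ Unreached S' i
    Unreached⊆span₁ i v∈U with unreached⁻ S i v∈U
    ... | v∈S , ¬reach with ∈S⇒∈S'⊎∈A v∈S
    ...   | inj₁ v∈S' = inj₁ (unreached⁺ S' i v∈S' ¬reach)
    ...   | inj₂ (k , v∈A) =
      A⊆span₁-Unreached k (>-wellFounded k) (≰⇒> (¬reach ∘ flip reach≤-mono (layer⇒reach≤ (layerA k v∈A)))) v∈A

    ∉S'⇒∈span₁-Unreached : ∀ {i v} → v ∉ S' → ¬ Reach≤ S (suc i) v → v ∈span₁ Unreached S' i
    ∉S'⇒∈span₁-Unreached {i} {v} v∉S' ¬reach with v ∈? S
    ... | yes v∈S = Unreached⊆span₁ i (unreached⁺ S i v∈S (¬reach ∘ reach≤-mono (n≤1+n i)))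
    ... | no v∉S = Span₁.∈span-trans (indep-⊆ M₁ (Unreached⊆ S i) iS₁) (indep-⊆ M₁ (Unreached⊆ S' i) indep₁-S')
                     (Unreached⊆span₁ i) v∈span
      where
      v∈span : v ∈span₁ Unreached S i
      v∈span = Span₁.∈span-of-no-exchange iS₁ v∉S (¬reach ∘ reach≤-mono (s≤s z≤n) ∘ reach≤-src ∘ s-arc v∉S)
                 (Unreached⊆ S i) λ x∈S x∉U → ¬reach ∘ reach≤-arc (∉Unreached⇒reach≤ S i x∈S x∉U) ∘ arc₁ x∈S v∉S

    layerB-inject₁ : ∀ k → InLayerSet S (suc (2 * toℕ k)) (Bs (inject₁ k))
    layerB-inject₁ k {b} b∈B = subst (λ t → InLayer S (suc (2 * t)) b) (Fin.toℕ-inject₁ k) (layerB (inject₁ k) b∈B)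

    A⊆Reached : ∀ k → As k ⊆ Reached S (aLayer k)
    A⊆Reached k v∈A = reached⁺ S _ (A~⊆S k (A⊆A~ k v∈A)) (layer⇒reach≤ (layerA k v∈A))

    B⊆span₂-Reached : ∀ k → Bs (inject₁ k) ⊆span₂ Reached S (aLayer k)
    B⊆span₂-Reached k {b} b∈B =
      Span₂.∈span-of-no-exchange iS₂ b∉S no-sink-arc (Reached⊆ S (aLayer k)) no-exchange
      where
      b∉S : b ∉ S
      b∉S = B~∩S=∅ (inject₁ k) (B⊆B~ (inject₁ k) b∈B)
      L : InLayer S (suc (2 * toℕ k)) b
      L = layerB-inject₁ k b∈B
      no-sink-arc : ¬ Indep M₂ (S ∪ ⁅ b ⁆)
      no-sink-arc i = <⇒≱ (s≤s (Fin.toℕ<n k)) (2*-≤-2+2* (dist-sink-≤ dist-s-t (layer⇒reach≤ L) (t-arc b∉S i)))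
      no-exchange : ∀ {x} → x ∈ S → x ∉ Reached S (aLayer k) → ¬ Indep M₂ ((S - x) ∪ ⁅ b ⁆)
      no-exchange {x} x∈S x∉Z =
        x∉Z ∘ reached⁺ S (aLayer k) x∈S ∘ subst (λ t → Reach≤ S t x) (sym (*-suc 2 (toℕ k)))
            ∘ reach≤-arc (layer⇒reach≤ L) ∘ arc₂ x∈S b∉S

    A⊆span₂-Reached : ∀ {m} k → Acc _<ᶠ_ k → aLayer k ≤ m → As k ⊆span₂ Reached S' m
    A⊆span₂-Reached {m} k (acc rs) 2[1+k]≤m {v} v∈A =
      Span₂.∈span-trans iJ (indep-⊆ M₂ (Reached⊆ S' m) indep₂-S') J⊆span (Z⊆span-J (A⊆Reached k v∈A))
      where
      Z J : Subset n
      Z = Reached S (aLayer k)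
      J = (Z ─ As k) ∪ Bs (inject₁ k)
      Z⊆S : Z ⊆ S
      Z⊆S = Reached⊆ S (aLayer k)
      iJ : Indep M₂ J
      iJ = indep-⊆ M₂ (∪-monoˡ (─-monoˡ Z⊆S)) (Π.exch₂ k)
      Z⊆span-J : Z ⊆span₂ J
      Z⊆span-J = Span₂.⊆span-exchange (indep-⊆ M₂ Z⊆S iS₂) iJ (A⊆Reached k) (B⊆span₂-Reached k)
                   (λ b∈B → B~∩S=∅ _ (B⊆B~ _ b∈B) ∘ Z⊆S) (trans (Π.sizeA k) (sym (Π.sizeB (inject₁ k))))
      J⊆span : J ⊆span₂ Reached S' m
      J⊆span y∈J with x∈p∪q⁻ (Z ─ As k) (Bs (inject₁ k)) y∈J
      ... | inj₂ y∈B = inj₁ (reached⁺ S' m (∈S'⁺ (inj₂ (inject₁ k , y∈B)))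
              (reach≤-mono (≤-trans (≤-trans (n≤1+n _) (≤-reflexive (sym (*-suc 2 (toℕ k))))) 2[1+k]≤m)
                           (layer⇒reach≤ (layerB-inject₁ k y∈B))))
      ... | inj₁ y∈Z─A with x∈p─q⁻ Z (As k) y∈Z─A
      ...   | y∈Z , y∉A with reached⁻ S _ y∈Z
      ...     | y∈S , reach with ∈S⇒∈S'⊎∈A y∈S
      ...       | inj₁ y∈S' = inj₁ (reached⁺ S' m y∈S' (reach≤-mono 2[1+k]≤m reach))
      ...       | inj₂ (k' , y∈A') = A⊆span₂-Reached k' (rs k'<k) (≤-trans (aLayer-mono (<⇒≤ k'<k)) 2[1+k]≤m) y∈A'
        where
        k'≤k : toℕ k' ≤ toℕ k
        k'≤k = ≤-pred (*-cancelˡ-≤ 2 (layer-≤ (layerA k' y∈A') reach))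
        k'<k : toℕ k' < toℕ k
        k'<k = ≤∧≢⇒< k'≤k λ k'≡k → y∉A (subst (λ k → _ ∈ As k) (Fin.toℕ-injective k'≡k) y∈A')

    Reached⊆span₂ : ∀ m → Reached S m ⊆span₂ Reached S' m
    Reached⊆span₂ m v∈R with reached⁻ S m v∈R
    ... | v∈S , reach with ∈S⇒∈S'⊎∈A v∈S
    ...   | inj₁ v∈S' = inj₁ (reached⁺ S' m v∈S' reach)
    ...   | inj₂ (k , v∈A) = A⊆span₂-Reached k (<-wellFounded k) (layer-≤ (layerA k v∈A) reach) v∈A

    ∉S'⇒∈span₂-Reached : ∀ {i v} → i ≤ 2 * ℓ → v ∉ S' → Reach≤ S i v → v ∈span₂ Reached S' (suc i)
    ∉S'⇒∈span₂-Reached {i} {v} i≤2ℓ v∉S' reach with v ∈? S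
    ... | yes v∈S = Reached⊆span₂ (suc i) (reached⁺ S (suc i) v∈S (reach≤-mono (n≤1+n i) reach))
    ... | no v∉S = Span₂.∈span-trans (indep-⊆ M₂ (Reached⊆ S (suc i)) iS₂) (indep-⊆ M₂ (Reached⊆ S' (suc i)) indep₂-S')
                     (Reached⊆span₂ (suc i)) v∈span
      where
      no-sink-arc : ¬ Indep M₂ (S ∪ ⁅ v ⁆)
      no-sink-arc = <⇒≱ (subst (suc i <_) (sym (*-suc 2 ℓ)) (s≤s (s≤s i≤2ℓ))) ∘ dist-sink-≤ dist-s-t reach ∘ t-arc v∉S
      v∈span : v ∈span₂ Reached S (suc i)
      v∈span = Span₂.∈span-of-no-exchange iS₂ v∉S no-sink-arc (Reached⊆ S (suc i))
                 λ x∈S x∉R → x∉R ∘ reached⁺ S (suc i) x∈S ∘ reach≤-arc reach ∘ arc₂ x∈S v∉S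

    reach≤-src' : ∀ {v} → Arc S' src (el v) → Reach≤ S 1 v
    reach≤-src' {v} (s-arc v∉S' iS'v) = decidable-stable (reach≤? S 1 v) λ ¬reach →
      Span₁.∉span v∉S' iS'v (Span₁.∈span-mono (Unreached⊆ S' 0) (∉S'⇒∈span₁-Unreached v∉S' ¬reach))

    -- Otherwise v is spanned by a subset of S' - u in the matroid of the arc, which contradicts the arc.
    reach≤-arc' : ∀ {i u v} → i ≤ 2 * ℓ → Reach≤ S i u → Arc S' (el u) (el v) → Reach≤ S (suc i) v
    reach≤-arc' {i} {u} {v} _ reach-u (arc₁ u∈S' v∉S' iS'uv) = decidable-stable (reach≤? S (suc i) v) λ ¬reach →
      Span₁.∉span (v∉S' ∘ proj₁ ∘ x∈p-y⁻ S') iS'uv (Span₁.∈span-mono U⊆S'-u (∉S'⇒∈span₁-Unreached v∉S' ¬reach))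
      where
      U⊆S'-u : Unreached S' i ⊆ S' - u
      U⊆S'-u x∈U with unreached⁻ S' i x∈U
      ... | x∈S' , ¬reach-x = x∈p∧x≢y⇒x∈p-y x∈S' λ x≡u → ¬reach-x (subst (Reach≤ S i) (sym x≡u) reach-u)
    reach≤-arc' {i} {u} {v} i≤2ℓ reach-u (arc₂ v∈S' u∉S' iS'vu) = decidable-stable (reach≤? S (suc i) v) λ ¬reach →
      Span₂.∉span (u∉S' ∘ proj₁ ∘ x∈p-y⁻ S') iS'vu
        (Span₂.∈span-mono (R⊆S'-v ¬reach) (∉S'⇒∈span₂-Reached i≤2ℓ u∉S' reach-u))
      where
      R⊆S'-v : ¬ Reach≤ S (suc i) v → Reached S' (suc i) ⊆ S' - v
      R⊆S'-v ¬reach x∈R with reached⁻ S' (suc i) x∈R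
      ... | x∈S' , reach-x = x∈p∧x≢y⇒x∈p-y x∈S' λ x≡v → ¬reach (subst (Reach≤ S (suc i)) x≡v reach-x)

    walk'⇒reach≤ : ∀ k {v} → Walk S' src (el v) k → k ≤ suc (2 * ℓ) → Reach≤ S k v
    walk'⇒reach≤ (suc k) p 1+k≤1+2ℓ with unsnoc p
    ... | src , q , a with refl ← walk-src-src q = reach≤-src' a
    ... | el u , q , a = reach≤-arc' (≤-pred 1+k≤1+2ℓ) (walk'⇒reach≤ k q (≤-trans (n≤1+n k) 1+k≤1+2ℓ)) a

    layer-lower-bound : ∀ {d v} → InLayer S d v → d ≤ suc (2 * ℓ) → ∀ j → j < d → ¬ Walk S' src (el v) j
    layer-lower-bound L d≤1+2ℓ j j<d p = <⇒≱ j<d (layer-≤ L (walk'⇒reach≤ j p (≤-trans (<⇒≤ j<d) d≤1+2ℓ)))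

    B'⊆B~ : ∀ j → B' j ⊆ Bs~ j
    B'⊆B~ j = p─q⊆p (Bs~ j) (Bs j)

    A'⊆A~ : ∀ i → A' i ⊆ As~ i
    A'⊆A~ i = p─q⊆p (As~ i) (As i)

    width' : ℕ
    width' = Π~.width ∸ Π.width

    ∣A'∣≡width' : ∀ i → ∣ A' i ∣ ≡ width'
    ∣A'∣≡width' i = trans (∣p─q∣≡∣p∣∸∣q∣ (As~ i) (As i) (A⊆A~ i)) (cong₂ _∸_ (Π~.sizeA i) (Π.sizeA i))

    ∣B'∣≡width' : ∀ j → ∣ B' j ∣ ≡ width'
    ∣B'∣≡width' j = trans (∣p─q∣≡∣p∣∸∣q∣ (Bs~ j) (Bs j) (B⊆B~ j)) (cong₂ _∸_ (Π~.sizeB j) (Π.sizeB j))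

    aLayer≤1+2ℓ : ∀ i → aLayer i ≤ suc (2 * ℓ)
    aLayer≤1+2ℓ i = m≤n⇒m≤1+n (*-monoʳ-≤ 2 (Fin.toℕ<n i))

    bLayer≤1+2ℓ : ∀ j → bLayer j ≤ suc (2 * ℓ)
    bLayer≤1+2ℓ j = s≤s (*-monoʳ-≤ 2 (≤-pred (Fin.toℕ<n j)))

    WalkToB' : Pred (Fin (suc ℓ)) 0ℓ
    WalkToB' j = ∀ {b} → b ∈ B' j → Walk S' src (el b) (bLayer j)

    walk-B'-zero : WalkToB' zero
    walk-B'-zero b∈B' = cons (s-arc (B'∩S'=∅ zero b∈B') (indep-⊆ M₁ (∪-monoʳ (x∈p⇒⁅x⁆⊆p b∈B')) first')) nil

    walk-B'-suc : ∀ k → (∀ {a} → a ∈ A' k → Walk S' src (el a) (aLayer k)) → WalkToB' (suc k)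
    walk-B'-suc k walk-A' {b} b∈B' with Fin.any? (λ a → a ∈? A' k ×-dec indep? M₁ ((S' - a) ∪ ⁅ b ⁆))
    ... | yes (a , a∈A' , i) = snoc (walk-A' a∈A') (arc₁ (A'⊆S' k a∈A') (B'∩S'=∅ (suc k) b∈B') i)
    ... | no no-exchange = ⊥-elim (Span₁.∉span (b∉S' ∘ p─q⊆p S' (A' k)) (indep-⊆ M₁ (∪-monoʳ (x∈p⇒⁅x⁆⊆p b∈B')) (exch₁' k))
                             (Span₁.∈span-of-no-exchange indep₁-S' b∉S' no-src-arc (p─q⊆p S' (A' k)) no-exchange'))
      where
      b∉S' : b ∉ S'
      b∉S' = B'∩S'=∅ (suc k) b∈B'
      no-src-arc : ¬ Indep M₁ (S' ∪ ⁅ b ⁆)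
      no-src-arc i = layer-lower-bound (Π~.layerB (suc k) (B'⊆B~ (suc k) b∈B')) (bLayer≤1+2ℓ (suc k))
                                       1 (s≤s (s≤s z≤n)) (cons (s-arc b∉S' i) nil)
      no-exchange' : ∀ {x} → x ∈ S' → x ∉ S' ─ A' k → ¬ Indep M₁ ((S' - x) ∪ ⁅ b ⁆)
      no-exchange' {x} x∈S' x∉S'─A' i =
        no-exchange (x , decidable-stable (x ∈? A' k) (x∉S'─A' ∘ x∈p∧x∉q⇒x∈p─q x∈S') , i)

    walk-A' : ∀ k → WalkToB' (inject₁ k) → ∀ {a} → a ∈ A' k → Walk S' src (el a) (aLayer k)
    walk-A' k walk-B' {a} a∈A' with indep-exch M₂ (indep-⊆ M₂ (p─q⊆p S' ⁅ a ⁆) indep₂-S') (exch₂' k) ∣S'-a∣<∣J∣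
      where
      ∣S'-a∣<∣J∣ : ∣ S' - a ∣ < ∣ (S' ─ A' k) ∪ B' (inject₁ k) ∣
      ∣S'-a∣<∣J∣ = ≤-reflexive (trans (1+∣p-x∣≡∣p∣ S' (A'⊆S' k a∈A'))
        (sym (∣p─q∪r∣≡∣p∣ S' (A' k) (B' (inject₁ k)) (A'⊆S' k) (B'∩S'=∅ (inject₁ k))
                          (trans (∣A'∣≡width' k) (sym (∣B'∣≡width' (inject₁ k)))))))
    ... | y , y∈J , y∉S'-a , i with x∈p∪q⁻ (S' ─ A' k) (B' (inject₁ k)) y∈J
    ...   | inj₂ y∈B' = subst (Walk S' src (el a)) 2+2k≡aLayer
                          (snoc (walk-B' y∈B') (arc₂ (A'⊆S' k a∈A') (B'∩S'=∅ (inject₁ k) y∈B') i))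
      where
      2+2k≡aLayer : suc (bLayer (inject₁ k)) ≡ aLayer k
      2+2k≡aLayer = trans (cong (λ t → suc (suc (2 * t))) (Fin.toℕ-inject₁ k)) (sym (*-suc 2 (toℕ k)))
    ...   | inj₁ y∈S'─A' with x∈p─q⁻ S' (A' k) y∈S'─A'
    ...     | y∈S' , y∉A' = ⊥-elim (y∉S'-a (x∈p∧x≢y⇒x∈p-y y∈S' λ y≡a → y∉A' (subst (_∈ A' k) (sym y≡a) a∈A')))

    walk-B' : ∀ j → WalkToB' j
    walk-B' = <-weakInduction WalkToB' walk-B'-zero (λ k → walk-B'-suc k ∘ walk-A' k)

    layerA' : ∀ i → InLayerSet S' (aLayer i) (A' i)
    layerA' i a∈A' = walk-A' i (walk-B' (inject₁ i)) a∈A'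
                   , layer-lower-bound (Π~.layerA i (A'⊆A~ i a∈A')) (aLayer≤1+2ℓ i)

    layerB' : ∀ j → InLayerSet S' (bLayer j) (B' j)
    layerB' j b∈B' = walk-B' j b∈B' , layer-lower-bound (Π~.layerB j (B'⊆B~ j b∈B')) (bLayer≤1+2ℓ j)

theorem6p13 : ∀ {n : ℕ} (M₁ M₂ : Matroid n) (S : Subset n) (ℓ : ℕ)
    (Bs : Fin (suc ℓ) → Subset n) (As : Fin ℓ → Subset n)
    (Bs~ : Fin (suc ℓ) → Subset n) (As~ : Fin ℓ → Subset n) →
    Indep M₁ S → Indep M₂ S →
    Exchange.Dist M₁ M₂ S (Exchange.src) (Exchange.sink) (2 * suc ℓ) →
    Exchange.IsAugmentingSet M₁ M₂ S ℓ Bs As →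
    Exchange.IsAugmentingSet M₁ M₂ S ℓ Bs~ As~ →
    (∀ i → Bs i ⊆ Bs~ i) → (∀ i → As i ⊆ As~ i) →
    Exchange.IsAugmentingSet M₁ M₂ (Exchange._⊕_ M₁ M₂ S (Bs , As)) ℓ
      (λ i → Bs~ i ─ Bs i) (λ i → As~ i ─ As i)
theorem6p13 M₁ M₂ S ℓ Bs As Bs~ As~ iS₁ iS₂ dist-s-t Π Π~ B⊆B~ A⊆A~ = record
  { width  = width'
  ; layerA = layerA'
  ; layerB = layerB'
  ; sizeA  = ∣A'∣≡width'
  ; sizeB  = ∣B'∣≡width'
  ; first  = first'
  ; last   = last'
  ; exch₁  = exch₁'
  ; exch₂  = exch₂'
  }
  where open AugmentingSets.Difference M₁ M₂ S ℓ iS₁ iS₂ dist-s-t Bs Bs~ As As~ Π Π~ B⊆B~ A⊆A~
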